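{- Let $m\ge 2$, $n\ge 1$, $0\le p\le m-1$. Order the vertices of ${\cal D}^*_m$ as $v_1,v_2,\dots$ with $v_1=0^m$, let ${\cal T}^*_m=[a_{ij}]$ be its adjacency matrix and $a^{(n)}_{ij}$ the $(i,j)$-entry of $({\cal T}^*_m)^n$. Then $$f^{TnC}_m(n)=a^{(n)}_{11},$$ $$f^{TG}_{m,p}(n)=\mathrm{tr}\big(({\cal R}^*_m)^p({\cal T}^*_m)^n\big)=\mathrm{tr}\big(({\cal T}^*_m)^n({\cal R}^*_m)^p\big)=\sum_{v_i,v_j\in V({\cal D}^*_m),\ v_i=\rho^p(v_j)}a^{(n)}_{ij},$$ $$f^{KB}_{m,p}(n)=\mathrm{tr}\big(({\cal R}^*_m)^p{\cal H}^*_m({\cal T}^*_m)^n\big)=\mathrm{tr}\big(({\cal T}^*_m)^n({\cal R}^*_m)^p{\cal H}^*_m\big)=\sum_{v_i,v_j\in V({\cal D}^*_m),\ \overline{v_i}=\rho^p(v_j)}a^{(n)}_{ij},$$ where $f^{TnC}_m(n)$, $f^{TG}_{m,p}(n)$, $f^{KB}_{m,p}(n)$ are the numbers of 2-factors of $TnC_m(n)$, $TG^{(p)}_m(n)$, $KB^{(p)}_m(n)$.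
   Context: Alpha-letters (2-element subsets of the directions up, down, left, right): $a=\{\text{right},\text{down}\}$, $b=\{\text{up},\text{down}\}$, $c=\{\text{right},\text{up}\}$, $d=\{\text{left},\text{down}\}$, $e=\{\text{left},\text{right}\}$, $f=\{\text{left},\text{up}\}$. ${\cal D}_{ud}$: arc $(\alpha,\beta)$ iff ($\text{down}\in\alpha\iff\text{up}\in\beta$); ${\cal D}_{lr}$: arc $(\alpha,\beta)$ iff ($\text{right}\in\alpha\iff\text{left}\in\beta$). ${\cal D}_m$: vertices are the words $\alpha_1\cdots\alpha_m\in\{a,\dots,f\}^m$ with $(\alpha_i,\alpha_{i+1})$ an arc of ${\cal D}_{ud}$ for $1\le i\le m$ ($\alpha_{m+1}:=\alpha_1$); arc $v\to u$ iff $(v_i,u_i)$ is an arc of ${\cal D}_{lr}$ for all $i$. Outlet word $o(\alpha)\in\{0,1\}^m$: $o_j=1$ iff $\alpha_j\in\{a,c,e\}$; inlet word $i(\alpha)$: $i_j=1$ iff $\alpha_j\in\{d,e,f\}$. ${\cal D}^*_m$: vertex set $\{o(x):x\in V({\cal D}_m)\}$, number of arcs from $v$ to $w$ equal to $|\{y\in V({\cal D}_m): i(y)=v,\ o(y)=w\}|$. For a binary word $v=b_1\cdots b_m$: $\overline{v}=b_m\cdots b_1$, $\rho(v)=b_2\cdots b_mb_1$, $\rho^p$ its $p$-th iterate. ${\cal R}^*_m=[r_{ij}]$ with $r_{ij}=1$ iff $\rho(v_i)=v_j$ (else 0); ${\cal H}^*_m=[h_{ij}]$ with $h_{ij}=1$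 iff $v_i=\overline{v_j}$ (else 0). Graphs: row indices mod $m$ in $\{1,\dots,m\}$. Multigraphs (loops/parallel edges allowed; for $m,n\ge 3$ the usual simple grids) on $\{1,\dots,m\}\times\{1,\dots,n\}$ with directed edge-ends: vertical edges joining $(i,j)$ (end "down") to $(i+1,j)$ (end "up") for all $i,j$; horizontal edges joining $(i,j)$ (end "right") to $(i,j+1)$ (end "left") for $j\le n-1$. $TnC_m(n)=C_m\times P_n$ has only these; $TG^{(p)}_m(n)$ also has, for each $i$, an edge joining $(i+p,n)$ (right) to $(i,1)$ (left); $KB^{(p)}_m(n)$ also has, for each $i$, an edge joining $(m+p+1-i,n)$ (right) to $(i,1)$ (left). A 2-factor is a set of edges such that every vertex carries exactly two edge-ends of chosen edges (a loop contributes two). -}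

module Defs where

open import Data.Bool using (Bool; true; false; if_then_else_)
import Data.Bool as Bool
open import Data.Nat using (ℕ; zero; suc; _+_; _*_; _∸_; NonZero)
open import Data.Nat.DivMod using (_mod_)
open import Data.Fin using (Fin; toℕ; inject₁; fromℕ)
import Data.Fin as Fin
import Data.Fin.Properties as FinP
open import Data.Product using (_×_; _,_)
open import Data.Product.Properties using () renaming (≡-dec to ×-≡-dec)
open import Data.Nat.ListAction using (sum)
open import Data.List using (List; []; _∷_; map; length; filter; concatMap; cartesianProduct; allFin; zipWith; _++_)
open import Data.List.Relation.Unary.All using (All; all?)
open import Data.List.Relation.Unary.Any using (any?)
open import Data.Vec using (Vec; []; _∷_; lookup; _∷ʳ_; reverse; replicate; toList)
import Data.Vec as Vec
open import Data.Vec.Properties using () renaming (≡-dec to vec-≡-dec)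
open import Relation.Nullary using (Dec; yes; no; ¬_)
open import Relation.Nullary.Decidable using (⌊_⌋; _×-dec_)
open import Relation.Binary.PropositionalEquality using (_≡_)

allVecs : {A : Set} → List A → (m : ℕ) → List (Vec A m)
allVecs xs zero    = [] ∷ []
allVecs xs (suc m) = concatMap (λ x → map (x ∷_) (allVecs xs m)) xs

countDec : {A : Set} {P : A → Set} → ((x : A) → Dec (P x)) → List A → ℕ
countDec P? xs = length (filter P? xs)

data Dir : Set where
  up down left right : Dir

data Letter : Set where
  a b c d e f : Letter

allLetters : List Letter
allLetters = a ∷ b ∷ c ∷ d ∷ e ∷ f ∷ []

has : Letter → Dir → Bool
has a right = true
has a down  = true
has b up    = true
has b down  = true
has c right = true
has c up    = true
has d left  = true
has d down  = true
has e left  = true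
has e right = true
has f left  = true
has f up    = true
has _ _     = false

UDArc : Letter → Letter → Set
UDArc α β = has α down ≡ has β up

LRArc : Letter → Letter → Set
LRArc α β = has α right ≡ has β left

Word : ℕ → Set
Word m = Vec Bool m

_≟W_ : {m : ℕ} → (v w : Word m) → Dec (v ≡ w)
_≟W_ = vec-≡-dec Bool._≟_

nextPos : {m : ℕ} → Fin m → Fin m
nextPos {suc m} i = (suc (toℕ i)) mod (suc m)

IsDmVertex : {m : ℕ} → Vec Letter m → Set
IsDmVertex {m} x = (i : Fin m) → UDArc (lookup x i) (lookup x (nextPos i))

isDmVertex? : {m : ℕ} → (x : Vec Letter m) → Dec (IsDmVertex x)
isDmVertex? x = FinP.all? (λ i → Bool._≟_ _ _)

VDm : (m : ℕ) → List (Vec Letter m)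
VDm m = filter isDmVertex? (allVecs allLetters m)

DmArc : {m : ℕ} → Vec Letter m → Vec Letter m → Set
DmArc {m} v u = (i : Fin m) → LRArc (lookup v i) (lookup u i)

outlet : {m : ℕ} → Vec Letter m → Word m
outlet = Vec.map (λ α → has α right)

inlet : {m : ℕ} → Vec Letter m → Word m
inlet = Vec.map (λ α → has α left)

-- vertex set of D*_m : { o(x) : x ∈ V(D_m) }, as a duplicate-free list
VStar : (m : ℕ) → List (Word m)
VStar m = filter (λ w → any? (λ x → outlet x ≟W w) (VDm m)) (allVecs (false ∷ true ∷ []) m)

-- square matrices indexed by V(D*_m) (only entries at vertices of D*_m matter)
Mat : ℕ → Set
Mat m = Word m → Word m → ℕ

_⊗_ : {m : ℕ} → Mat m → Mat m → Mat m
_⊗_ {m} M N v w = sum (map (λ u → M v u * N u w) (VStar m))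

infixl 7 _⊗_

idMat : {m : ℕ} → Mat m
idMat v w = if ⌊ v ≟W w ⌋ then 1 else 0

_^M_ : {m : ℕ} → Mat m → ℕ → Mat m
M ^M zero    = idMat
M ^M (suc k) = (M ^M k) ⊗ M

tr : {m : ℕ} → Mat m → ℕ
tr {m} M = sum (map (λ v → M v v) (VStar m))

TStar : (m : ℕ) → Mat m
TStar m v w = countDec (λ y → (inlet y ≟W v) ×-dec (outlet y ≟W w)) (VDm m)

ρ : {m : ℕ} → Word m → Word m
ρ []       = []
ρ (x ∷ xs) = xs ∷ʳ x

ρ^ : {m : ℕ} → ℕ → Word m → Word m
ρ^ zero    v = v
ρ^ (suc k) v = ρ^ k (ρ v)

bar : {m : ℕ} → Word m → Word m
bar = reverse

RStar : (m : ℕ) → Mat m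
RStar m v w = if ⌊ ρ v ≟W w ⌋ then 1 else 0

HStar : (m : ℕ) → Mat m
HStar m v w = if ⌊ v ≟W bar w ⌋ then 1 else 0

zeroWord : (m : ℕ) → Word m
zeroWord m = replicate m false

-- vertex (i , j) : 0-based row i ∈ Fin m, 0-based column j ∈ Fin n
Vtx : ℕ → ℕ → Set
Vtx m n = Fin m × Fin n

-- an edge is recorded by its two edge-ends (the vertices carrying them);
-- a loop has both ends at the same vertex
Edge : ℕ → ℕ → Set
Edge m n = Vtx m n × Vtx m n

_≟V_ : {m n : ℕ} → (u v : Vtx m n) → Dec (u ≡ v)
_≟V_ = ×-≡-dec FinP._≟_ FinP._≟_

-- 0-based row corresponding to the 1-based row index r (r ≥ 1), taken mod m
row : (m : ℕ) .{{_ : NonZero m}} → ℕ → Fin m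
row m r = (r ∸ 1) mod m

-- vertical edges: (i,j) [down] -- (i+1,j) [up], all i, j  (1-based i)
vertEdges : (m n : ℕ) .{{_ : NonZero m}} → List (Edge m n)
vertEdges m n = map (λ ij → let i = Data.Product.proj₁ ij ; j = Data.Product.proj₂ ij in
                       ((i , j) , (row m (toℕ i + 2) , j)))
                    (cartesianProduct (allFin m) (allFin n))

horEdges : (m n : ℕ) → List (Edge m n)
horEdges m zero    = []
horEdges m (suc n) = map (λ ij → let i = Data.Product.proj₁ ij ; j = Data.Product.proj₂ ij in
                            ((i , inject₁ j) , (i , Fin.suc j)))
                         (cartesianProduct (allFin m) (allFin n))

TnCEdges : (m n : ℕ) .{{_ : NonZero m}} → List (Edge m n)
TnCEdges m n = vertEdges m n ++ horEdges m n

-- extra edges of TG^{(p)}_m(n): (i+p, n) [right] -- (i, 1) [left]   (1-based i)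
TGExtra : (m n p : ℕ) .{{_ : NonZero m}} → List (Edge m n)
TGExtra m zero    p = []
TGExtra m (suc n) p = map (λ i → ((row m (toℕ i + 1 + p) , fromℕ n) , (i , Fin.zero))) (allFin m)

-- extra edges of KB^{(p)}_m(n): (m+p+1-i, n) [right] -- (i, 1) [left]   (1-based i)
KBExtra : (m n p : ℕ) .{{_ : NonZero m}} → List (Edge m n)
KBExtra m zero    p = []
KBExtra m (suc n) p = map (λ i → ((row m (m + p + 1 ∸ (toℕ i + 1)) , fromℕ n) , (i , Fin.zero))) (allFin m)

TGEdges : (m n p : ℕ) .{{_ : NonZero m}} → List (Edge m n)
TGEdges m n p = TnCEdges m n ++ TGExtra m n p

KBEdges : (m n p : ℕ) .{{_ : NonZero m}} → List (Edge m n)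
KBEdges m n p = TnCEdges m n ++ KBExtra m n p

-- number of edge-ends of the edge carried by vertex v (a loop at v gives 2)
endsAt : {m n : ℕ} → Edge m n → Vtx m n → ℕ
endsAt (x , y) v = (if ⌊ x ≟V v ⌋ then 1 else 0) + (if ⌊ y ≟V v ⌋ then 1 else 0)

-- a choice of edges is a Boolean vector indexed by the edge list;
-- degree of v = number of edge-ends at v of chosen edges
chosenDeg : {m n : ℕ} → (es : List (Edge m n)) → Vec Bool (length es) → Vtx m n → ℕ
chosenDeg es S v = sum (zipWith (λ e s → if s then endsAt e v else 0) es (toList S))

allVtx : (m n : ℕ) → List (Vtx m n)
allVtx m n = cartesianProduct (allFin m) (allFin n)

IsTwoFactor : {m n : ℕ} → (es : List (Edge m n)) → Vec Bool (length es) → Set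
IsTwoFactor {m} {n} es S = All (λ v → chosenDeg es S v ≡ 2) (allVtx m n)

isTwoFactor? : {m n : ℕ} → (es : List (Edge m n)) → (S : Vec Bool (length es)) → Dec (IsTwoFactor es S)
isTwoFactor? es S = all? (λ v → chosenDeg es S v Data.Nat.≟ 2) _

numTwoFactors : {m n : ℕ} → List (Edge m n) → ℕ
numTwoFactors es = countDec (isTwoFactor? es) (allVecs (false ∷ true ∷ []) (length es))

fTnC : (m n : ℕ) .{{_ : NonZero m}} → ℕ
fTnC m n = numTwoFactors (TnCEdges m n)

fTG : (m n p : ℕ) .{{_ : NonZero m}} → ℕ
fTG m n p = numTwoFactors (TGEdges m n p)

fKB : (m n p : ℕ) .{{_ : NonZero m}} → ℕ
fKB m n p = numTwoFactors (KBEdges m n p)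

-- A 2-factor chooses at every vertex the two directions of its chosen edge-ends, i.e. an alpha-letter,
-- and conversely a letter array comes from a 2-factor iff the two ends of every edge agree. Reading the grid
-- column by column, the vertical edges say that each column of letters is a vertex y of D_m, and the
-- horizontal edges say that the inlet word of a column is the outlet word of the previous one. Since every
-- binary word is an outlet word, V(D*_m) is all of {0,1}^m and y is an arc i(y) → o(y) of D*_m, so the
-- 2-factors are walks of length n in D*_m: from 0^m to 0^m for TnC (no edge-ends leave the grid), and closed
-- up to the extra edges for TG and KB, which identify the inlet word of the first column with the outlet word
-- of the last one rotated by ρ^p, resp. rotated and reversed. Counting these walks gives a twisted trace
-- ∑_u (T*^n)(B u, u), and R*^p and H* are the permutation matrices turning it into the stated traces.

module Submission where

open import Defs
open import Data.Bool using (Bool; true; false; if_then_else_)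
import Data.Bool as Bool
open import Data.Empty using (⊥-elim)
open import Data.Fin using (Fin; zero; suc; toℕ; inject₁; fromℕ; opposite)
import Data.Fin as Fin
open import Data.Fin.Properties using (toℕ-injective; toℕ-fromℕ<; toℕ<n; toℕ-inject₁; toℕ-fromℕ; opposite-prop; opposite-involutive; fromℕ≢inject₁; inject₁-injective) renaming (suc-injective to fsuc-injective)
open import Data.Fin.Relation.Unary.Top using (view; ‵fromℕ; ‵inj₁)
open import Data.List using (List; []; _∷_; map; length; filter; concatMap; _++_; allFin; cartesianProduct)
open import Data.List.Membership.Propositional using (_∈_; lose)
open import Data.List.Membership.Propositional.Properties using (∈-cartesianProduct⁺; ∈-allFin; ∈-map⁻; ∈-++⁻; ∈-filter⁺)
open import Data.List.Properties using (map-++; map-∘; map-cong; ++-identityʳ; map-tabulate)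
open import Data.List.Relation.Unary.All using (All; all?) renaming (lookup to All-lookup; tabulate to All-tabulate)
open import Data.List.Relation.Unary.Any using (Any; here; there; any?)
open import Data.Maybe using (Maybe; just; nothing)
open import Data.Maybe.Properties using (just-injective)
open import Data.Nat using (ℕ; zero; suc; _+_; _*_; _∸_; _≤_; _<_; z≤n; s≤s; NonZero)
import Data.Nat as ℕ
open import Data.Nat.DivMod using (_mod_; _%_; m%n<n; m<n⇒m%n≡m; %-distribˡ-+; m%n%n≡m%n; [m+n]%n≡m%n; n%n≡0)
open import Data.Nat.ListAction using (sum)
open import Data.Nat.ListAction.Properties using (sum-++)
open import Data.Nat.Properties
open import Data.Nat.Tactic.RingSolver using (solve-∀)
open import Data.Product using (_×_; _,_; proj₁; proj₂)
open import Data.Product.Properties using () renaming (≡-dec to ×-≡-dec)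
open import Data.Sum using (inj₁; inj₂)
open import Data.Vec using (Vec; []; _∷_; lookup; reverse; _∷ʳ_) renaming (tabulate to tabulateᵛ)
import Data.Vec.Properties as Vecₚ
open import Function using (_∘_)
open import Relation.Binary using (DecidableEquality)
open import Relation.Binary.PropositionalEquality
open import Relation.Nullary using (Dec; yes; no; ¬_)
open import Relation.Nullary.Decidable using (⌊_⌋; _×-dec_; map′)
open import Relation.Unary using (Decidable)

-- Finite sums and counting

∑ : {A : Set} → List A → (A → ℕ) → ℕ
∑ xs g = sum (map g xs)

syntax ∑ xs (λ x → g) = ∑[ x ∈ xs ] g

⟦_⟧ : {P : Set} → Dec P → ℕ
⟦ P? ⟧ = if ⌊ P? ⌋ then 1 else 0

⟦⟧-yes : {P : Set} (P? : Dec P) → P → ⟦ P? ⟧ ≡ 1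
⟦⟧-yes (yes _) _ = refl
⟦⟧-yes (no ¬p) p = ⊥-elim (¬p p)

⟦⟧-no : {P : Set} (P? : Dec P) → ¬ P → ⟦ P? ⟧ ≡ 0
⟦⟧-no (yes p) ¬p = ⊥-elim (¬p p)
⟦⟧-no (no _) _ = refl

⟦⟧-⇔ : {P Q : Set} (P? : Dec P) (Q? : Dec Q) → (P → Q) → (Q → P) → ⟦ P? ⟧ ≡ ⟦ Q? ⟧
⟦⟧-⇔ (yes p) Q? to _    = sym (⟦⟧-yes Q? (to p))
⟦⟧-⇔ (no ¬p) Q? _ from = sym (⟦⟧-no Q? (λ q → ¬p (from q)))

⟦⟧-× : {P Q : Set} (P? : Dec P) (Q? : Dec Q) → ⟦ P? ×-dec Q? ⟧ ≡ ⟦ P? ⟧ * ⟦ Q? ⟧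
⟦⟧-× (yes _) (yes _) = refl
⟦⟧-× (yes _) (no _)  = refl
⟦⟧-× (no _)  _       = refl

⟦≟⟧-sym : {A : Set} (_≟_ : DecidableEquality A) (x y : A) → ⟦ x ≟ y ⟧ ≡ ⟦ y ≟ x ⟧
⟦≟⟧-sym _≟_ x y = ⟦⟧-⇔ (x ≟ y) (y ≟ x) sym sym

if-then-0 : {P : Set} (P? : Dec P) (x : ℕ) → (if ⌊ P? ⌋ then x else 0) ≡ ⟦ P? ⟧ * x
if-then-0 (yes _) x = sym (+-identityʳ x)
if-then-0 (no _)  x = refl

∑-++ : {A : Set} (xs ys : List A) (g : A → ℕ) → ∑ (xs ++ ys) g ≡ ∑ xs g + ∑ ys g
∑-++ xs ys g = trans (cong sum (map-++ g xs ys)) (sum-++ (map g xs) (map g ys))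

∑-map : {A B : Set} (h : A → B) (xs : List A) (g : B → ℕ) → ∑ (map h xs) g ≡ ∑[ x ∈ xs ] g (h x)
∑-map h xs g = cong sum (sym (map-∘ xs))

∑-concatMap : {A B : Set} (h : A → List B) (xs : List A) (g : B → ℕ) →
  ∑ (concatMap h xs) g ≡ ∑[ x ∈ xs ] ∑ (h x) g
∑-concatMap h [] g = refl
∑-concatMap h (x ∷ xs) g =
  trans (∑-++ (h x) (concatMap h xs) g) (cong (∑ (h x) g +_) (∑-concatMap h xs g))

∑-cartesianProduct : {A B : Set} (xs : List A) (ys : List B) (g : A × B → ℕ) →
  ∑ (cartesianProduct xs ys) g ≡ ∑[ x ∈ xs ] ∑[ y ∈ ys ] g (x , y)
∑-cartesianProduct [] ys g = refl
∑-cartesianProduct (x ∷ xs) ys g =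
  trans (∑-++ (map (x ,_) ys) _ g) (cong₂ _+_ (∑-map (x ,_) ys g) (∑-cartesianProduct xs ys g))

∑-cong : {A : Set} (xs : List A) {g h : A → ℕ} → (∀ x → g x ≡ h x) → ∑ xs g ≡ ∑ xs h
∑-cong xs g≗h = cong sum (map-cong g≗h xs)

∑-cong-∈ : {A : Set} (xs : List A) {g h : A → ℕ} → (∀ x → x ∈ xs → g x ≡ h x) → ∑ xs g ≡ ∑ xs h
∑-cong-∈ [] g≗h = refl
∑-cong-∈ (x ∷ xs) g≗h = cong₂ _+_ (g≗h x (here refl)) (∑-cong-∈ xs (λ y y∈ → g≗h y (there y∈)))

∑-zero : {A : Set} (xs : List A) → ∑[ x ∈ xs ] 0 ≡ 0
∑-zero [] = refl
∑-zero (x ∷ xs) = ∑-zero xs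

∑-+ : {A : Set} (xs : List A) (g h : A → ℕ) → ∑[ x ∈ xs ] (g x + h x) ≡ ∑ xs g + ∑ xs h
∑-+ [] g h = refl
∑-+ (x ∷ xs) g h = trans (cong (g x + h x +_) (∑-+ xs g h)) (interchange (g x) (h x) (∑ xs g) (∑ xs h))
  where
  interchange : ∀ p q r s → p + q + (r + s) ≡ p + r + (q + s)
  interchange = solve-∀

∑-*ˡ : {A : Set} (xs : List A) (k : ℕ) (g : A → ℕ) → ∑[ x ∈ xs ] (k * g x) ≡ k * ∑ xs g
∑-*ˡ [] k g = sym (*-zeroʳ k)
∑-*ˡ (x ∷ xs) k g = trans (cong (k * g x +_) (∑-*ˡ xs k g)) (sym (*-distribˡ-+ k (g x) (∑ xs g)))

∑-*ʳ : {A : Set} (xs : List A) (k : ℕ) (g : A → ℕ) → ∑[ x ∈ xs ] (g x * k) ≡ ∑ xs g * k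
∑-*ʳ xs k g = trans (∑-cong xs (λ x → *-comm (g x) k)) (trans (∑-*ˡ xs k g) (*-comm k _))

∑-comm : {A B : Set} (xs : List A) (ys : List B) (g : A → B → ℕ) →
  ∑[ x ∈ xs ] ∑[ y ∈ ys ] g x y ≡ ∑[ y ∈ ys ] ∑[ x ∈ xs ] g x y
∑-comm [] ys g = sym (∑-zero ys)
∑-comm (x ∷ xs) ys g =
  trans (cong (∑ ys (g x) +_) (∑-comm xs ys g)) (sym (∑-+ ys (g x) (λ y → ∑[ x′ ∈ xs ] g x′ y)))

∑-filter : {A : Set} {P : A → Set} (P? : Decidable P) (xs : List A) (g : A → ℕ) →
  ∑ (filter P? xs) g ≡ ∑[ x ∈ xs ] (⟦ P? x ⟧ * g x)
∑-filter P? [] g = refl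
∑-filter P? (x ∷ xs) g with P? x
... | yes _ = cong₂ _+_ (sym (+-identityʳ (g x))) (∑-filter P? xs g)
... | no _  = ∑-filter P? xs g

length-filter : {A : Set} {P : A → Set} (P? : Decidable P) (xs : List A) →
  length (filter P? xs) ≡ ∑[ x ∈ xs ] ⟦ P? x ⟧
length-filter P? [] = refl
length-filter P? (x ∷ xs) with P? x
... | yes _ = cong suc (length-filter P? xs)
... | no _  = length-filter P? xs

∈⇒≤∑ : {A : Set} {xs : List A} {x : A} (g : A → ℕ) → x ∈ xs → g x ≤ ∑ xs g
∈⇒≤∑ {xs = y ∷ xs} g (here refl) = m≤m+n (g y) _
∈⇒≤∑ {xs = y ∷ xs} g (there x∈) = ≤-trans (∈⇒≤∑ g x∈) (m≤n+m _ (g y))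

count : {A : Set} → DecidableEquality A → List A → A → ℕ
count _≟_ xs x = ∑[ y ∈ xs ] ⟦ y ≟ x ⟧

Enumerates : {A : Set} → DecidableEquality A → List A → Set
Enumerates _≟_ xs = ∀ x → count _≟_ xs x ≡ 1

∑-⟦≟⟧-* : {A : Set} (_≟_ : DecidableEquality A) (xs : List A) (x : A) (g : A → ℕ) →
  ∑[ y ∈ xs ] (⟦ y ≟ x ⟧ * g y) ≡ count _≟_ xs x * g x
∑-⟦≟⟧-* _≟_ xs x g = trans (∑-cong xs at-x) (∑-*ʳ xs (g x) (λ y → ⟦ y ≟ x ⟧))
  where
  at-x : ∀ y → ⟦ y ≟ x ⟧ * g y ≡ ⟦ y ≟ x ⟧ * g x
  at-x y with y ≟ x
  ... | yes refl = refl
  ... | no _     = refl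

∑-pick : {A : Set} (_≟_ : DecidableEquality A) (xs : List A) → Enumerates _≟_ xs →
  (x : A) (g : A → ℕ) → ∑[ y ∈ xs ] (⟦ y ≟ x ⟧ * g y) ≡ g x
∑-pick _≟_ xs enum x g =
  trans (∑-⟦≟⟧-* _≟_ xs x g) (trans (cong (_* g x) (enum x)) (+-identityʳ (g x)))

∑-pick′ : {A : Set} (_≟_ : DecidableEquality A) (xs : List A) → Enumerates _≟_ xs →
  (x : A) (g : A → ℕ) → ∑[ y ∈ xs ] (⟦ x ≟ y ⟧ * g y) ≡ g x
∑-pick′ _≟_ xs enum x g =
  trans (∑-cong xs (λ y → cong (_* g y) (⟦≟⟧-sym _≟_ x y))) (∑-pick _≟_ xs enum x g)

count-filter : {A : Set} (_≟_ : DecidableEquality A) {P : A → Set} (P? : Decidable P) (xs : List A) (x : A) →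
  count _≟_ (filter P? xs) x ≡ count _≟_ xs x * ⟦ P? x ⟧
count-filter _≟_ P? xs x =
  trans (∑-filter P? xs _)
    (trans (∑-cong xs (λ y → *-comm ⟦ P? y ⟧ ⟦ y ≟ x ⟧)) (∑-⟦≟⟧-* _≟_ xs x (λ y → ⟦ P? y ⟧)))

count≡1⇒∈ : {A : Set} (_≟_ : DecidableEquality A) (xs : List A) (x : A) → count _≟_ xs x ≡ 1 → x ∈ xs
count≡1⇒∈ _≟_ (y ∷ xs) x once with y ≟ x
... | yes refl = here refl
... | no _     = there (count≡1⇒∈ _≟_ xs x once)

allVecs-enumerates : {A : Set} (_≟_ : DecidableEquality A) {xs : List A} → Enumerates _≟_ xs →
  ∀ k → Enumerates (Vecₚ.≡-dec _≟_) (allVecs xs k)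
allVecs-enumerates _≟_ enum zero [] = refl
allVecs-enumerates _≟_ {xs} enum (suc k) (x ∷ v) = begin
  count _≟ᵥ_ (allVecs xs (suc k)) (x ∷ v)
    ≡⟨ ∑-concatMap (λ y → map (y ∷_) (allVecs xs k)) xs _ ⟩
  ∑[ y ∈ xs ] ∑ (map (y ∷_) (allVecs xs k)) (λ u → ⟦ u ≟ᵥ (x ∷ v) ⟧)
    ≡⟨ ∑-cong xs (λ y → ∑-map (y ∷_) (allVecs xs k) _) ⟩
  ∑[ y ∈ xs ] ∑[ w ∈ allVecs xs k ] ⟦ (y ∷ w) ≟ᵥ (x ∷ v) ⟧
    ≡⟨ ∑-cong xs (λ y → ∑-cong (allVecs xs k) (λ w → ⟦∷≟∷⟧ y w)) ⟩
  ∑[ y ∈ xs ] ∑[ w ∈ allVecs xs k ] (⟦ y ≟ x ⟧ * ⟦ w ≟ᵥ v ⟧)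
    ≡⟨ ∑-cong xs (λ y → ∑-*ˡ (allVecs xs k) ⟦ y ≟ x ⟧ _) ⟩
  ∑[ y ∈ xs ] (⟦ y ≟ x ⟧ * count _≟ᵥ_ (allVecs xs k) v)
    ≡⟨ ∑-cong xs (λ y → cong (⟦ y ≟ x ⟧ *_) (allVecs-enumerates _≟_ enum k v)) ⟩
  ∑[ y ∈ xs ] (⟦ y ≟ x ⟧ * 1)
    ≡⟨ ∑-pick _≟_ xs enum x (λ _ → 1) ⟩
  1 ∎
  where
  open ≡-Reasoning
  _≟ᵥ_ : ∀ {n} → DecidableEquality (Vec _ n)
  _≟ᵥ_ = Vecₚ.≡-dec _≟_
  ⟦∷≟∷⟧ : ∀ y w → ⟦ (y ∷ w) ≟ᵥ (x ∷ v) ⟧ ≡ ⟦ y ≟ x ⟧ * ⟦ w ≟ᵥ v ⟧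
  ⟦∷≟∷⟧ y w = trans (⟦⟧-⇔ ((y ∷ w) ≟ᵥ (x ∷ v)) ((y ≟ x) ×-dec (w ≟ᵥ v))
                            Vecₚ.∷-injective (λ (p , q) → cong₂ _∷_ p q))
                    (⟦⟧-× (y ≟ x) (w ≟ᵥ v))

-- Double counting of the pairs (x , y) with P x and y = Φ x, equivalently Q y and x = Ψ y.
count-bijection : {A B : Set} (_≟A_ : DecidableEquality A) (_≟B_ : DecidableEquality B)
  {xs : List A} {ys : List B} {P : A → Set} {Q : B → Set} (P? : Decidable P) (Q? : Decidable Q)
  (Φ : A → B) (Ψ : B → A) → Enumerates _≟A_ xs → Enumerates _≟B_ ys →
  (∀ x → P x → Q (Φ x)) → (∀ x → P x → Ψ (Φ x) ≡ x) →
  (∀ y → Q y → P (Ψ y)) → (∀ y → Q y → Φ (Ψ y) ≡ y) →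
  ∑[ x ∈ xs ] ⟦ P? x ⟧ ≡ ∑[ y ∈ ys ] ⟦ Q? y ⟧
count-bijection _≟A_ _≟B_ {xs} {ys} P? Q? Φ Ψ enumA enumB PΦ ΨΦ QΨ ΦΨ = begin
  ∑[ x ∈ xs ] ⟦ P? x ⟧
    ≡⟨ ∑-cong xs (λ x → sym (∑-pick _≟B_ ys enumB (Φ x) (λ _ → ⟦ P? x ⟧))) ⟩
  ∑[ x ∈ xs ] ∑[ y ∈ ys ] (⟦ y ≟B Φ x ⟧ * ⟦ P? x ⟧)
    ≡⟨ ∑-comm xs ys _ ⟩
  ∑[ y ∈ ys ] ∑[ x ∈ xs ] (⟦ y ≟B Φ x ⟧ * ⟦ P? x ⟧)
    ≡⟨ ∑-cong ys (λ y → ∑-cong xs (λ x → graph-symmetric x y)) ⟩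
  ∑[ y ∈ ys ] ∑[ x ∈ xs ] (⟦ x ≟A Ψ y ⟧ * ⟦ Q? y ⟧)
    ≡⟨ ∑-cong ys (λ y → ∑-pick _≟A_ xs enumA (Ψ y) (λ _ → ⟦ Q? y ⟧)) ⟩
  ∑[ y ∈ ys ] ⟦ Q? y ⟧ ∎
  where
  open ≡-Reasoning
  graph-symmetric : ∀ x y → ⟦ y ≟B Φ x ⟧ * ⟦ P? x ⟧ ≡ ⟦ x ≟A Ψ y ⟧ * ⟦ Q? y ⟧
  graph-symmetric x y = trans (sym (⟦⟧-× (y ≟B Φ x) (P? x)))
    (trans (⟦⟧-⇔ ((y ≟B Φ x) ×-dec P? x) ((x ≟A Ψ y) ×-dec Q? y)
       (λ { (refl , p) → sym (ΨΦ x p) , PΦ x p })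
       (λ { (refl , q) → sym (ΦΨ y q) , QΨ y q }))
     (⟦⟧-× (x ≟A Ψ y) (Q? y)))

-- Letters, words and the vertices of D*_m

letterCode : Letter → ℕ
letterCode a = 0
letterCode b = 1
letterCode c = 2
letterCode d = 3
letterCode e = 4
letterCode f = 5

letterCode-injective : ∀ x y → letterCode x ≡ letterCode y → x ≡ y
letterCode-injective a a _ = refl
letterCode-injective b b _ = refl
letterCode-injective c c _ = refl
letterCode-injective d d _ = refl
letterCode-injective e e _ = refl
letterCode-injective f f _ = refl

_≟ᴸ_ : DecidableEquality Letter
x ≟ᴸ y = map′ (letterCode-injective x y) (cong letterCode) (letterCode x ℕ.≟ letterCode y)

_≟ᶜ_ : {m : ℕ} → DecidableEquality (Vec Letter m)
_≟ᶜ_ = Vecₚ.≡-dec _≟ᴸ_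

allLetters-enumerates : Enumerates _≟ᴸ_ allLetters
allLetters-enumerates a = refl
allLetters-enumerates b = refl
allLetters-enumerates c = refl
allLetters-enumerates d = refl
allLetters-enumerates e = refl
allLetters-enumerates f = refl

allBools : List Bool
allBools = false ∷ true ∷ []

allBools-enumerates : Enumerates Bool._≟_ allBools
allBools-enumerates false = refl
allBools-enumerates true  = refl

allWords-enumerates : ∀ m → Enumerates _≟W_ (allVecs allBools m)
allWords-enumerates = allVecs-enumerates Bool._≟_ allBools-enumerates

allColumns : (m : ℕ) → List (Vec Letter m)
allColumns = allVecs allLetters

allColumns-enumerates : ∀ m → Enumerates _≟ᶜ_ (allColumns m)
allColumns-enumerates = allVecs-enumerates _≟ᴸ_ allLetters-enumerates

≗-lookup⇒≡ : {A : Set} {n : ℕ} (u w : Vec A n) → (∀ i → lookup u i ≡ lookup w i) → u ≡ w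
≗-lookup⇒≡ u w u≗w =
  trans (sym (Vecₚ.tabulate∘lookup u)) (trans (Vecₚ.tabulate-cong u≗w) (Vecₚ.tabulate∘lookup w))

lookup-outlet : ∀ {m} (x : Vec Letter m) i → lookup (outlet x) i ≡ has (lookup x i) right
lookup-outlet x i = Vecₚ.lookup-map i (λ α → has α right) x

lookup-inlet : ∀ {m} (x : Vec Letter m) i → lookup (inlet x) i ≡ has (lookup x i) left
lookup-inlet x i = Vecₚ.lookup-map i (λ α → has α left) x

letterWith : (out in′ : Bool) → Letter
letterWith true  true  = e
letterWith true  false = a
letterWith false false = b
letterWith false true  = f

letterWith-right : ∀ o i → has (letterWith o i) right ≡ o
letterWith-right true  true  = refl
letterWith-right true  false = refl
letterWith-right false false = refl
letterWith-right false true  = refl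

letterWith-up : ∀ o i → has (letterWith o i) up ≡ Bool.not o
letterWith-up true  true  = refl
letterWith-up true  false = refl
letterWith-up false false = refl
letterWith-up false true  = refl

letterWith-down : ∀ o i → has (letterWith o i) down ≡ Bool.not i
letterWith-down true  true  = refl
letterWith-down true  false = refl
letterWith-down false false = refl
letterWith-down false true  = refl

-- letterWith o i has up = not o and down = not i, so taking the inlet of row i to be the outlet of
-- row i + 1 makes the column a vertex of D_m.
columnWithOutlet : ∀ {m} → Word m → Vec Letter m
columnWithOutlet w = tabulateᵛ (λ i → letterWith (lookup w i) (lookup w (nextPos i)))

outlet-columnWithOutlet : ∀ {m} (w : Word m) → outlet (columnWithOutlet w) ≡ w
outlet-columnWithOutlet w = ≗-lookup⇒≡ _ w λ i →
  trans (lookup-outlet (columnWithOutlet w) i)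
    (trans (cong (λ α → has α right) (Vecₚ.lookup∘tabulate _ i)) (letterWith-right _ _))

columnWithOutlet-isDmVertex : ∀ {m} (w : Word m) → IsDmVertex (columnWithOutlet w)
columnWithOutlet-isDmVertex w i =
  trans (cong (λ α → has α down) (Vecₚ.lookup∘tabulate _ i))
    (trans (letterWith-down _ _)
      (trans (sym (letterWith-up _ _)) (cong (λ α → has α up) (sym (Vecₚ.lookup∘tabulate _ (nextPos i))))))

VStar-enumerates : ∀ m → Enumerates _≟W_ (VStar m)
VStar-enumerates m w = begin
  count _≟W_ (VStar m) w                              ≡⟨ count-filter _≟W_ isOutlet? (allVecs allBools m) w ⟩
  count _≟W_ (allVecs allBools m) w * ⟦ isOutlet? w ⟧ ≡⟨ cong (_* ⟦ isOutlet? w ⟧) (allWords-enumerates m w) ⟩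
  ⟦ isOutlet? w ⟧ + 0                                 ≡⟨ +-identityʳ _ ⟩
  ⟦ isOutlet? w ⟧                                     ≡⟨ ⟦⟧-yes (isOutlet? w) w-isOutlet ⟩
  1                                                   ∎
  where
  open ≡-Reasoning
  isOutlet? : (w : Word m) → Dec (Any (λ y → outlet y ≡ w) (VDm m))
  isOutlet? w = any? (λ y → outlet y ≟W w) (VDm m)
  w-isOutlet : Any (λ y → outlet y ≡ w) (VDm m)
  w-isOutlet = lose (∈-filter⁺ isDmVertex? (count≡1⇒∈ _≟ᶜ_ (allColumns m) _ (allColumns-enumerates m _))
                                           (columnWithOutlet-isDmVertex w))
                    (outlet-columnWithOutlet w)

-- Walks in D*_m and powers of T*_m

Columns : ℕ → ℕ → Set
Columns m k = Vec (Vec Letter m) k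

allColumnSeqs : (m k : ℕ) → List (Columns m k)
allColumnSeqs m = allVecs (allColumns m)

allColumnSeqs-enumerates : ∀ m k → Enumerates (Vecₚ.≡-dec _≟ᶜ_) (allColumnSeqs m k)
allColumnSeqs-enumerates m = allVecs-enumerates _≟ᶜ_ (allColumns-enumerates m)

IsWalk : ∀ {m k} → Word m → Columns m k → Word m → Set
IsWalk v []      w = v ≡ w
IsWalk v (y ∷ Y) w = (IsDmVertex y × inlet y ≡ v) × IsWalk (outlet y) Y w

isWalk? : ∀ {m k} (v : Word m) (Y : Columns m k) (w : Word m) → Dec (IsWalk v Y w)
isWalk? v []      w = v ≟W w
isWalk? v (y ∷ Y) w = (isDmVertex? y ×-dec (inlet y ≟W v)) ×-dec isWalk? (outlet y) Y w

#walks : ∀ {m} → ℕ → Word m → Word m → ℕ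
#walks {m} k v w = ∑[ Y ∈ allColumnSeqs m k ] ⟦ isWalk? v Y w ⟧

enters : ∀ {m} → Vec Letter m → Word m → ℕ
enters y v = ⟦ isDmVertex? y ×-dec (inlet y ≟W v) ⟧

#walks-suc : ∀ {m} k (v w : Word m) →
  #walks (suc k) v w ≡ ∑[ y ∈ allColumns m ] (enters y v * #walks k (outlet y) w)
#walks-suc {m} k v w =
  trans (∑-concatMap _ (allColumns m) _) (∑-cong (allColumns m) λ y →
    trans (∑-map (y ∷_) (allColumnSeqs m k) _)
      (trans (∑-cong (allColumnSeqs m k) (λ Y → ⟦⟧-× (isDmVertex? y ×-dec (inlet y ≟W v)) (isWalk? (outlet y) Y w)))
        (∑-*ˡ (allColumnSeqs m k) (enters y v) _)))

TStar-columns : ∀ {m} (v w : Word m) → TStar m v w ≡ ∑[ y ∈ allColumns m ] (enters y v * ⟦ outlet y ≟W w ⟧)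
TStar-columns {m} v w =
  trans (length-filter _ (VDm m)) (trans (∑-filter isDmVertex? (allColumns m) _) (∑-cong (allColumns m) λ y →
    trans (cong (⟦ isDmVertex? y ⟧ *_) (⟦⟧-× (inlet y ≟W v) (outlet y ≟W w)))
      (trans (sym (*-assoc ⟦ isDmVertex? y ⟧ _ _))
        (cong (_* ⟦ outlet y ≟W w ⟧) (sym (⟦⟧-× (isDmVertex? y) (inlet y ≟W v)))))))

#walks-zero : ∀ {m} (v w : Word m) → #walks 0 v w ≡ ⟦ v ≟W w ⟧
#walks-zero v w = +-identityʳ _

#walks-extend : ∀ {m} k (v w : Word m) → ∑[ u ∈ VStar m ] (#walks k v u * TStar m u w) ≡ #walks (suc k) v w
#walks-extend {m} zero v w = begin
  ∑[ u ∈ VStar m ] (#walks 0 v u * TStar m u w)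
    ≡⟨ ∑-cong (VStar m) (λ u → cong (_* TStar m u w) (#walks-zero v u)) ⟩
  ∑[ u ∈ VStar m ] (⟦ v ≟W u ⟧ * TStar m u w)
    ≡⟨ ∑-pick′ _≟W_ (VStar m) (VStar-enumerates m) v (λ u → TStar m u w) ⟩
  TStar m v w
    ≡⟨ TStar-columns v w ⟩
  ∑[ y ∈ allColumns m ] (enters y v * ⟦ outlet y ≟W w ⟧)
    ≡⟨ ∑-cong (allColumns m) (λ y → cong (enters y v *_) (sym (#walks-zero (outlet y) w))) ⟩
  ∑[ y ∈ allColumns m ] (enters y v * #walks 0 (outlet y) w)
    ≡⟨ sym (#walks-suc zero v w) ⟩
  #walks 1 v w ∎
  where open ≡-Reasoning
#walks-extend {m} (suc k) v w = begin
  ∑[ u ∈ VStar m ] (#walks (suc k) v u * TStar m u w)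
    ≡⟨ ∑-cong (VStar m) (λ u → trans (cong (_* TStar m u w) (#walks-suc k v u)) (sym (∑-*ʳ (allColumns m) _ _))) ⟩
  ∑[ u ∈ VStar m ] ∑[ y ∈ allColumns m ] (enters y v * #walks k (outlet y) u * TStar m u w)
    ≡⟨ ∑-comm (VStar m) (allColumns m) _ ⟩
  ∑[ y ∈ allColumns m ] ∑[ u ∈ VStar m ] (enters y v * #walks k (outlet y) u * TStar m u w)
    ≡⟨ ∑-cong (allColumns m) (λ y → ∑-cong (VStar m) (λ u → *-assoc (enters y v) _ _)) ⟩
  ∑[ y ∈ allColumns m ] ∑[ u ∈ VStar m ] (enters y v * (#walks k (outlet y) u * TStar m u w))
    ≡⟨ ∑-cong (allColumns m) (λ y → trans (∑-*ˡ (VStar m) (enters y v) _)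
                                           (cong (enters y v *_) (#walks-extend k (outlet y) w))) ⟩
  ∑[ y ∈ allColumns m ] (enters y v * #walks (suc k) (outlet y) w)
    ≡⟨ sym (#walks-suc (suc k) v w) ⟩
  #walks (suc (suc k)) v w ∎
  where open ≡-Reasoning

TStar^-walks : ∀ {m} k (v w : Word m) → (TStar m ^M k) v w ≡ #walks k v w
TStar^-walks zero v w = sym (#walks-zero v w)
TStar^-walks {m} (suc k) v w =
  trans (∑-cong (VStar m) (λ u → cong (_* TStar m u w) (TStar^-walks k v u))) (#walks-extend k v w)

lastColumn : ∀ {m k} → Columns m (suc k) → Vec Letter m
lastColumn {k = k} Y = lookup Y (fromℕ k)

IsWalk⇒end : ∀ {m k} (v : Word m) (Y : Columns m (suc k)) (w : Word m) → IsWalk v Y w → w ≡ outlet (lastColumn Y)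
IsWalk⇒end v (y ∷ [])     w (_ , refl)  = refl
IsWalk⇒end v (y ∷ y′ ∷ Y) w (_ , walk) = IsWalk⇒end (outlet y) (y′ ∷ Y) w walk

Chained : ∀ {m k} → Columns m (suc k) → Set
Chained {k = k} Y = ∀ (j : Fin k) → inlet (lookup Y (suc j)) ≡ outlet (lookup Y (inject₁ j))

IsWalk⇒columns : ∀ {m k} (v : Word m) (Y : Columns m (suc k)) (w : Word m) → IsWalk v Y w →
  (∀ j → IsDmVertex (lookup Y j)) × inlet (lookup Y zero) ≡ v × Chained Y × outlet (lastColumn Y) ≡ w
IsWalk⇒columns v (y ∷ []) w ((vertex , entry) , exit) = (λ { zero → vertex }) , entry , (λ ()) , exit
IsWalk⇒columns v (y ∷ y′ ∷ Y) w ((vertex , entry) , walk)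
  with IsWalk⇒columns (outlet y) (y′ ∷ Y) w walk
... | vertices , entry′ , chained , exit =
  (λ { zero → vertex ; (suc j) → vertices j }) , entry , (λ { zero → entry′ ; (suc j) → chained j }) , exit

columns⇒IsWalk : ∀ {m k} (v : Word m) (Y : Columns m (suc k)) (w : Word m) →
  (∀ j → IsDmVertex (lookup Y j)) → inlet (lookup Y zero) ≡ v → Chained Y → outlet (lastColumn Y) ≡ w → IsWalk v Y w
columns⇒IsWalk v (y ∷ [])     w vertices entry chained exit = (vertices zero , entry) , exit
columns⇒IsWalk v (y ∷ y′ ∷ Y) w vertices entry chained exit =
  (vertices zero , entry) , columns⇒IsWalk (outlet y) (y′ ∷ Y) w (vertices ∘ suc) (chained zero) (chained ∘ suc) exit

TwistedClosedWalk : ∀ {m k} → (Word m → Word m) → Columns m (suc k) → Set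
TwistedClosedWalk B Y = IsWalk (B (outlet (lastColumn Y))) Y (outlet (lastColumn Y))

twistedClosedWalk? : ∀ {m k} (B : Word m → Word m) (Y : Columns m (suc k)) → Dec (TwistedClosedWalk B Y)
twistedClosedWalk? B Y = isWalk? _ Y _

∑-TStar^-twisted : ∀ {m} k (B : Word m → Word m) →
  ∑[ u ∈ VStar m ] (TStar m ^M suc k) (B u) u ≡ ∑[ Y ∈ allColumnSeqs m (suc k) ] ⟦ twistedClosedWalk? B Y ⟧
∑-TStar^-twisted {m} k B =
  trans (∑-cong (VStar m) (λ u → TStar^-walks (suc k) (B u) u))
    (trans (∑-comm (VStar m) (allColumnSeqs m (suc k)) _) (∑-cong (allColumnSeqs m (suc k)) λ Y →
      trans (∑-cong (VStar m) (only-end Y)) (∑-pick _≟W_ (VStar m) (VStar-enumerates m) _ _)))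
  where
  only-end : ∀ Y u → ⟦ isWalk? (B u) Y u ⟧
                     ≡ ⟦ u ≟W outlet (lastColumn Y) ⟧ * ⟦ isWalk? (B (outlet (lastColumn Y))) Y (outlet (lastColumn Y)) ⟧
  only-end Y u with u ≟W outlet (lastColumn Y)
  ... | yes refl = sym (+-identityʳ _)
  ... | no u≢end = ⟦⟧-no (isWalk? (B u) Y u) (λ walk → u≢end (IsWalk⇒end (B u) Y u walk))

-- The rotation and reflection matrices

ρ-ρ^ : ∀ {m} p (v : Word m) → ρ (ρ^ p v) ≡ ρ^ p (ρ v)
ρ-ρ^ zero    v = refl
ρ-ρ^ (suc p) v = ρ-ρ^ p (ρ v)

RStar^-entry : ∀ {m} p (v u : Word m) → (RStar m ^M p) v u ≡ ⟦ ρ^ p v ≟W u ⟧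
RStar^-entry zero    v u = refl
RStar^-entry {m} (suc p) v u =
  trans (∑-cong (VStar m) (λ w → cong (_* RStar m w u) (RStar^-entry p v w)))
    (trans (∑-pick′ _≟W_ (VStar m) (VStar-enumerates m) (ρ^ p v) (λ w → RStar m w u))
      (cong (λ z → ⟦ z ≟W u ⟧) (ρ-ρ^ p v)))

⟦≟bar⟧-swap : ∀ {m} (x y : Word m) → ⟦ x ≟W bar y ⟧ ≡ ⟦ y ≟W bar x ⟧
⟦≟bar⟧-swap x y = ⟦⟧-⇔ (x ≟W bar y) (y ≟W bar x) flip flip
  where
  flip : ∀ {x y : Word _} → x ≡ bar y → y ≡ bar x
  flip {x} {y} refl = sym (Vecₚ.reverse-involutive y)

twistedTrace : ∀ {m} → Mat m → (Word m → Word m) → ℕ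
twistedTrace {m} M B = ∑[ u ∈ VStar m ] M (B u) u

module Traces {m : ℕ} (M : Mat m) (p : ℕ) where

  private
    pick : (x : Word m) (g : Word m → ℕ) → ∑[ y ∈ VStar m ] (⟦ y ≟W x ⟧ * g y) ≡ g x
    pick = ∑-pick _≟W_ (VStar m) (VStar-enumerates m)

    pick′ : (x : Word m) (g : Word m → ℕ) → ∑[ y ∈ VStar m ] (⟦ x ≟W y ⟧ * g y) ≡ g x
    pick′ = ∑-pick′ _≟W_ (VStar m) (VStar-enumerates m)

    ∑∑-comm : (g : Word m → Word m → ℕ) →
      ∑[ x ∈ VStar m ] ∑[ y ∈ VStar m ] g x y ≡ ∑[ y ∈ VStar m ] ∑[ x ∈ VStar m ] g x y
    ∑∑-comm = ∑-comm (VStar m) (VStar m)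

  tr-R^p⊗M : tr ((RStar m ^M p) ⊗ M) ≡ twistedTrace M (ρ^ p)
  tr-R^p⊗M = ∑-cong (VStar m) λ v →
    trans (∑-cong (VStar m) (λ u → cong (_* M u v) (RStar^-entry p v u))) (pick′ (ρ^ p v) (λ u → M u v))

  tr-M⊗R^p : tr (M ⊗ (RStar m ^M p)) ≡ twistedTrace M (ρ^ p)
  tr-M⊗R^p =
    trans (∑-cong (VStar m) (λ v → ∑-cong (VStar m) (λ u →
             trans (cong (M v u *_) (RStar^-entry p u v)) (*-comm (M v u) _))))
      (trans (∑∑-comm _) (∑-cong (VStar m) (λ u → pick′ (ρ^ p u) (λ v → M v u))))

  ∑-ρ^-pairs : sum (map (λ vi → sum (map (λ vj → if ⌊ vi ≟W ρ^ p vj ⌋ then M vi vj else 0) (VStar m))) (VStar m))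
               ≡ twistedTrace M (ρ^ p)
  ∑-ρ^-pairs =
    trans (∑-cong (VStar m) (λ vi → ∑-cong (VStar m) (λ vj → if-then-0 (vi ≟W ρ^ p vj) (M vi vj))))
      (trans (∑∑-comm _) (∑-cong (VStar m) (λ vj → pick (ρ^ p vj) (λ vi → M vi vj))))

  R^p⊗H-entry : ∀ v u → ((RStar m ^M p) ⊗ HStar m) v u ≡ ⟦ u ≟W bar (ρ^ p v) ⟧
  R^p⊗H-entry v u =
    trans (∑-cong (VStar m) (λ w → cong (_* HStar m w u) (RStar^-entry p v w)))
      (trans (pick′ (ρ^ p v) (λ w → HStar m w u)) (⟦≟bar⟧-swap (ρ^ p v) u))

  tr-R^p⊗H⊗M : tr ((RStar m ^M p) ⊗ HStar m ⊗ M) ≡ twistedTrace M (λ u → bar (ρ^ p u))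
  tr-R^p⊗H⊗M = ∑-cong (VStar m) λ v →
    trans (∑-cong (VStar m) (λ u → cong (_* M u v) (R^p⊗H-entry v u))) (pick (bar (ρ^ p v)) (λ u → M u v))

  tr-M⊗R^p⊗H : tr (M ⊗ (RStar m ^M p) ⊗ HStar m) ≡ twistedTrace M (λ u → bar (ρ^ p u))
  tr-M⊗R^p⊗H = begin
    ∑[ v ∈ VStar m ] ∑[ w ∈ VStar m ] ((M ⊗ (RStar m ^M p)) v w * HStar m w v)
      ≡⟨ ∑-cong (VStar m) (λ v → trans (∑-cong (VStar m) (λ w → *-comm ((M ⊗ (RStar m ^M p)) v w) _))
                                       (pick (bar v) (λ w → (M ⊗ (RStar m ^M p)) v w))) ⟩
    ∑[ v ∈ VStar m ] ∑[ u ∈ VStar m ] (M v u * (RStar m ^M p) u (bar v))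
      ≡⟨ ∑-cong (VStar m) (λ v → ∑-cong (VStar m) (λ u →
           trans (cong (M v u *_) (trans (RStar^-entry p u (bar v)) (⟦≟bar⟧-swap (ρ^ p u) v))) (*-comm (M v u) _))) ⟩
    ∑[ v ∈ VStar m ] ∑[ u ∈ VStar m ] (⟦ v ≟W bar (ρ^ p u) ⟧ * M v u)
      ≡⟨ ∑∑-comm _ ⟩
    ∑[ u ∈ VStar m ] ∑[ v ∈ VStar m ] (⟦ v ≟W bar (ρ^ p u) ⟧ * M v u)
      ≡⟨ ∑-cong (VStar m) (λ u → pick (bar (ρ^ p u)) (λ v → M v u)) ⟩
    twistedTrace M (λ u → bar (ρ^ p u)) ∎
    where open ≡-Reasoning

  ∑-barρ^-pairs : sum (map (λ vi → sum (map (λ vj → if ⌊ bar vi ≟W ρ^ p vj ⌋ then M vi vj else 0) (VStar m))) (VStar m))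
                  ≡ twistedTrace M (λ u → bar (ρ^ p u))
  ∑-barρ^-pairs =
    trans (∑-cong (VStar m) (λ vi → ∑-cong (VStar m) (λ vj →
             trans (if-then-0 (bar vi ≟W ρ^ p vj) (M vi vj)) (cong (_* M vi vj) (bar-transpose vi vj)))))
      (trans (∑∑-comm _) (∑-cong (VStar m) (λ vj → pick (bar (ρ^ p vj)) (λ vi → M vi vj))))
    where
    bar-transpose : ∀ vi vj → ⟦ bar vi ≟W ρ^ p vj ⟧ ≡ ⟦ vi ≟W bar (ρ^ p vj) ⟧
    bar-transpose vi vj = ⟦⟧-⇔ (bar vi ≟W ρ^ p vj) (vi ≟W bar (ρ^ p vj))
      (λ eq → trans (sym (Vecₚ.reverse-involutive vi)) (cong bar eq))
      (λ eq → trans (cong bar eq) (Vecₚ.reverse-involutive _))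

-- 2-factors of port graphs and letter arrays

dirCode : Dir → ℕ
dirCode up    = 0
dirCode down  = 1
dirCode left  = 2
dirCode right = 3

dirCode-injective : ∀ δ δ′ → dirCode δ ≡ dirCode δ′ → δ ≡ δ′
dirCode-injective up    up    _ = refl
dirCode-injective down  down  _ = refl
dirCode-injective left  left  _ = refl
dirCode-injective right right _ = refl

_≟ᴰ_ : DecidableEquality Dir
δ ≟ᴰ δ′ = map′ (dirCode-injective δ δ′) (cong dirCode) (dirCode δ ℕ.≟ dirCode δ′)

allDirs : List Dir
allDirs = up ∷ down ∷ left ∷ right ∷ []

∈-allDirs : ∀ δ → δ ∈ allDirs
∈-allDirs up    = here refl
∈-allDirs down  = there (here refl)
∈-allDirs left  = there (there (here refl))
∈-allDirs right = there (there (there (here refl)))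

∑-allDirs-⟦≟⟧ : ∀ δ → ∑[ δ′ ∈ allDirs ] ⟦ δ ≟ᴰ δ′ ⟧ ≡ 1
∑-allDirs-⟦≟⟧ up    = refl
∑-allDirs-⟦≟⟧ down  = refl
∑-allDirs-⟦≟⟧ left  = refl
∑-allDirs-⟦≟⟧ right = refl

mirror : Dir → Dir
mirror up    = down
mirror down  = up
mirror left  = right
mirror right = left

fromBool : Bool → ℕ
fromBool true  = 1
fromBool false = 0

-- Inverse of fromBool on 0 and 1 only.
toBool : ℕ → Bool
toBool zero    = false
toBool (suc _) = true

fromBool-toBool : ∀ k → k ≤ 1 → fromBool (toBool k) ≡ k
fromBool-toBool zero          _ = refl
fromBool-toBool (suc zero)    _ = refl
fromBool-toBool (suc (suc _)) (s≤s ())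

toBool-fromBool : ∀ x → toBool (fromBool x) ≡ x
toBool-fromBool true  = refl
toBool-fromBool false = refl

fromBool≤1 : ∀ x → fromBool x ≤ 1
fromBool≤1 true  = s≤s z≤n
fromBool≤1 false = z≤n

fromBool-injective : ∀ x y → fromBool x ≡ fromBool y → x ≡ y
fromBool-injective true  true  _ = refl
fromBool-injective false false _ = refl

-- The letter with the given (up, down, left, right) membership bits; junk unless exactly two are set.
letterOf : Bool → Bool → Bool → Bool → Letter
letterOf false true  false true  = a
letterOf true  true  false false = b
letterOf true  false false true  = c
letterOf false true  true  false = d
letterOf false false true  true  = e
letterOf true  false true  false = f
letterOf _     _     _     _     = a

letterOfBits : (Dir → Bool) → Letter
letterOfBits bits = letterOf (bits up) (bits down) (bits left) (bits right)

letterOfBits-cong : ∀ {bits bits′} → (∀ δ → bits δ ≡ bits′ δ) → letterOfBits bits ≡ letterOfBits bits′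
letterOfBits-cong same = trans (cong₂ (λ u d′ → letterOf u d′ _ _) (same up) (same down))
                               (cong₂ (letterOf _ _) (same left) (same right))

letterOf-has : ∀ ℓ → letterOfBits (has ℓ) ≡ ℓ
letterOf-has a = refl
letterOf-has b = refl
letterOf-has c = refl
letterOf-has d = refl
letterOf-has e = refl
letterOf-has f = refl

∑-allDirs-has : ∀ ℓ → ∑[ δ ∈ allDirs ] fromBool (has ℓ δ) ≡ 2
∑-allDirs-has a = refl
∑-allDirs-has b = refl
∑-allDirs-has c = refl
∑-allDirs-has d = refl
∑-allDirs-has e = refl
∑-allDirs-has f = refl

letterOf-spec : ∀ u d′ l r → fromBool u + (fromBool d′ + (fromBool l + (fromBool r + 0))) ≡ 2 →
  let ℓ = letterOf u d′ l r in (has ℓ up ≡ u) × (has ℓ down ≡ d′) × (has ℓ left ≡ l) × (has ℓ right ≡ r)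
letterOf-spec false true  false true  _ = refl , refl , refl , refl
letterOf-spec true  true  false false _ = refl , refl , refl , refl
letterOf-spec true  false false true  _ = refl , refl , refl , refl
letterOf-spec false true  true  false _ = refl , refl , refl , refl
letterOf-spec false false true  true  _ = refl , refl , refl , refl
letterOf-spec true  false true  false _ = refl , refl , refl , refl
letterOf-spec false false false false ()
letterOf-spec false false false true  ()
letterOf-spec false false true  false ()
letterOf-spec false true  false false ()
letterOf-spec true  false false false ()
letterOf-spec false true  true  true  ()
letterOf-spec true  false true  true  ()
letterOf-spec true  true  false true  ()
letterOf-spec true  true  true  false ()
letterOf-spec true  true  true  true  ()

has-letterOfBits : (bits : Dir → Bool) → ∑[ δ ∈ allDirs ] fromBool (bits δ) ≡ 2 →
  ∀ δ → has (letterOfBits bits) δ ≡ bits δ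
has-letterOfBits bits two δ with letterOf-spec (bits up) (bits down) (bits left) (bits right) two
has-letterOfBits bits two up    | u , _ , _ , _ = u
has-letterOfBits bits two down  | _ , d′ , _ , _ = d′
has-letterOfBits bits two left  | _ , _ , l , _ = l
has-letterOfBits bits two right | _ , _ , _ , r = r

module PortGraph (m n : ℕ) where

  Port : Set
  Port = Vtx m n × Dir

  _≟ₚ_ : DecidableEquality Port
  _≟ₚ_ = ×-≡-dec _≟V_ _≟ᴰ_

  -- The edge-end at the first vertex has the tagged direction, the one at the second vertex its mirror.
  TaggedEdge : Set
  TaggedEdge = Dir × Edge m n

  tailPort : TaggedEdge → Port
  tailPort (δ , (x , _)) = (x , δ)

  headPort : TaggedEdge → Port
  headPort (δ , (_ , y)) = (y , mirror δ)

  tailCount : List TaggedEdge → Port → ℕ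
  tailCount tes κ = ∑[ t ∈ tes ] ⟦ tailPort t ≟ₚ κ ⟧

  Choice : List TaggedEdge → Set
  Choice tes = Vec Bool (length (map proj₂ tes))

  choice : (tes : List TaggedEdge) → (TaggedEdge → Bool) → Choice tes
  choice []        φ = []
  choice (t ∷ tes) φ = φ t ∷ choice tes φ

  choice-cong : (tes : List TaggedEdge) {φ χ : TaggedEdge → Bool} → (∀ t → t ∈ tes → φ t ≡ χ t) →
    choice tes φ ≡ choice tes χ
  choice-cong []        φ≗χ = refl
  choice-cong (t ∷ tes) φ≗χ =
    cong₂ _∷_ (φ≗χ t (here refl)) (choice-cong tes (λ t′ t′∈ → φ≗χ t′ (there t′∈)))

  ∑chosen : (tes : List TaggedEdge) → Choice tes → (TaggedEdge → ℕ) → ℕ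
  ∑chosen []        []      g = 0
  ∑chosen (t ∷ tes) (s ∷ S) g = fromBool s * g t + ∑chosen tes S g

  ∑chosen-cong-∈ : (tes : List TaggedEdge) (S : Choice tes) {g h : TaggedEdge → ℕ} →
    (∀ t → t ∈ tes → g t ≡ h t) → ∑chosen tes S g ≡ ∑chosen tes S h
  ∑chosen-cong-∈ []        []      g≗h = refl
  ∑chosen-cong-∈ (t ∷ tes) (s ∷ S) g≗h =
    cong₂ _+_ (cong (fromBool s *_) (g≗h t (here refl))) (∑chosen-cong-∈ tes S (λ t′ t′∈ → g≗h t′ (there t′∈)))

  ∑chosen-zero : (tes : List TaggedEdge) (S : Choice tes) → ∑chosen tes S (λ _ → 0) ≡ 0
  ∑chosen-zero []        []      = refl
  ∑chosen-zero (t ∷ tes) (s ∷ S) = trans (cong (_+ ∑chosen tes S (λ _ → 0)) (*-zeroʳ (fromBool s))) (∑chosen-zero tes S)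

  ∑chosen-+ : (tes : List TaggedEdge) (S : Choice tes) (g h : TaggedEdge → ℕ) →
    ∑chosen tes S (λ t → g t + h t) ≡ ∑chosen tes S g + ∑chosen tes S h
  ∑chosen-+ []        []      g h = refl
  ∑chosen-+ (t ∷ tes) (s ∷ S) g h =
    trans (cong (fromBool s * (g t + h t) +_) (∑chosen-+ tes S g h)) (rearrange (fromBool s) (g t) (h t) _ _)
    where
    rearrange : ∀ x p q r w → x * (p + q) + (r + w) ≡ x * p + r + (x * q + w)
    rearrange = solve-∀

  ∑chosen-∑ : {A : Set} (tes : List TaggedEdge) (S : Choice tes) (xs : List A) (g : TaggedEdge → A → ℕ) →
    ∑chosen tes S (λ t → ∑[ x ∈ xs ] g t x) ≡ ∑[ x ∈ xs ] ∑chosen tes S (λ t → g t x)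
  ∑chosen-∑ []        []      xs g = sym (∑-zero xs)
  ∑chosen-∑ (t ∷ tes) (s ∷ S) xs g =
    trans (cong₂ _+_ (sym (∑-*ˡ xs (fromBool s) (g t))) (∑chosen-∑ tes S xs g))
      (sym (∑-+ xs (λ x → fromBool s * g t x) (λ x → ∑chosen tes S (λ t′ → g t′ x))))

  ∑chosen≤∑ : (tes : List TaggedEdge) (S : Choice tes) (g : TaggedEdge → ℕ) → ∑chosen tes S g ≤ ∑ tes g
  ∑chosen≤∑ []        []      g = z≤n
  ∑chosen≤∑ (t ∷ tes) (s ∷ S) g =
    +-mono-≤ (≤-trans (*-monoˡ-≤ (g t) (fromBool≤1 s)) (≤-reflexive (+-identityʳ (g t)))) (∑chosen≤∑ tes S g)

  ∑chosen-choice : (tes : List TaggedEdge) (φ : TaggedEdge → Bool) (g : TaggedEdge → ℕ) →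
    ∑chosen tes (choice tes φ) g ≡ ∑[ t ∈ tes ] (fromBool (φ t) * g t)
  ∑chosen-choice []        φ g = refl
  ∑chosen-choice (t ∷ tes) φ g = cong (fromBool (φ t) * g t +_) (∑chosen-choice tes φ g)

  tailLoad : (tes : List TaggedEdge) → Choice tes → Port → ℕ
  tailLoad tes S κ = ∑chosen tes S (λ t → ⟦ tailPort t ≟ₚ κ ⟧)

  headLoad : (tes : List TaggedEdge) → Choice tes → Port → ℕ
  headLoad tes S κ = ∑chosen tes S (λ t → ⟦ headPort t ≟ₚ κ ⟧)

  ∑-allDirs-⟦≟ₚ⟧ : ∀ (x v : Vtx m n) δ → ∑[ δ′ ∈ allDirs ] ⟦ (x , δ) ≟ₚ (v , δ′) ⟧ ≡ ⟦ x ≟V v ⟧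
  ∑-allDirs-⟦≟ₚ⟧ x v δ = begin
    ∑[ δ′ ∈ allDirs ] ⟦ (x , δ) ≟ₚ (v , δ′) ⟧
      ≡⟨ ∑-cong allDirs (λ δ′ → trans (⟦⟧-⇔ ((x , δ) ≟ₚ (v , δ′)) ((x ≟V v) ×-dec (δ ≟ᴰ δ′))
                                          (λ { refl → refl , refl }) (λ { (refl , refl) → refl }))
                                       (⟦⟧-× (x ≟V v) (δ ≟ᴰ δ′))) ⟩
    ∑[ δ′ ∈ allDirs ] (⟦ x ≟V v ⟧ * ⟦ δ ≟ᴰ δ′ ⟧)
      ≡⟨ ∑-*ˡ allDirs ⟦ x ≟V v ⟧ (λ δ′ → ⟦ δ ≟ᴰ δ′ ⟧) ⟩
    ⟦ x ≟V v ⟧ * ∑[ δ′ ∈ allDirs ] ⟦ δ ≟ᴰ δ′ ⟧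
      ≡⟨ trans (cong (⟦ x ≟V v ⟧ *_) (∑-allDirs-⟦≟⟧ δ)) (*-identityʳ _) ⟩
    ⟦ x ≟V v ⟧ ∎
    where open ≡-Reasoning

  endsAt-ports : ∀ t v →
    endsAt (proj₂ t) v ≡ ∑[ δ ∈ allDirs ] (⟦ tailPort t ≟ₚ (v , δ) ⟧ + ⟦ headPort t ≟ₚ (v , δ) ⟧)
  endsAt-ports (δ , (x , y)) v =
    sym (trans (∑-+ allDirs (λ δ′ → ⟦ (x , δ) ≟ₚ (v , δ′) ⟧) (λ δ′ → ⟦ (y , mirror δ) ≟ₚ (v , δ′) ⟧))
               (cong₂ _+_ (∑-allDirs-⟦≟ₚ⟧ x v δ) (∑-allDirs-⟦≟ₚ⟧ y v (mirror δ))))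

  chosenDeg-loads : ∀ (tes : List TaggedEdge) (S : Choice tes) v →
    chosenDeg (map proj₂ tes) S v ≡ ∑[ δ ∈ allDirs ] (tailLoad tes S (v , δ) + headLoad tes S (v , δ))
  chosenDeg-loads tes S v = begin
    chosenDeg (map proj₂ tes) S v
      ≡⟨ chosenDeg-∑chosen tes S ⟩
    ∑chosen tes S (λ t → endsAt (proj₂ t) v)
      ≡⟨ ∑chosen-cong-∈ tes S (λ t _ → endsAt-ports t v) ⟩
    ∑chosen tes S (λ t → ∑[ δ ∈ allDirs ] (⟦ tailPort t ≟ₚ (v , δ) ⟧ + ⟦ headPort t ≟ₚ (v , δ) ⟧))
      ≡⟨ ∑chosen-∑ tes S allDirs (λ t δ → ⟦ tailPort t ≟ₚ (v , δ) ⟧ + ⟦ headPort t ≟ₚ (v , δ) ⟧) ⟩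
    ∑[ δ ∈ allDirs ] ∑chosen tes S (λ t → ⟦ tailPort t ≟ₚ (v , δ) ⟧ + ⟦ headPort t ≟ₚ (v , δ) ⟧)
      ≡⟨ ∑-cong allDirs (λ δ → ∑chosen-+ tes S (λ t → ⟦ tailPort t ≟ₚ (v , δ) ⟧)
                                                (λ t → ⟦ headPort t ≟ₚ (v , δ) ⟧)) ⟩
    ∑[ δ ∈ allDirs ] (tailLoad tes S (v , δ) + headLoad tes S (v , δ)) ∎
    where
    open ≡-Reasoning
    chosenDeg-∑chosen : ∀ tes (S : Choice tes) →
      chosenDeg (map proj₂ tes) S v ≡ ∑chosen tes S (λ t → endsAt (proj₂ t) v)
    chosenDeg-∑chosen []        []          = refl
    chosenDeg-∑chosen (t ∷ tes) (true ∷ S)  = cong₂ _+_ (sym (+-identityʳ _)) (chosenDeg-∑chosen tes S)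
    chosenDeg-∑chosen (t ∷ tes) (false ∷ S) = chosenDeg-∑chosen tes S

  1≤tailCount : ∀ {tes t} → t ∈ tes → 1 ≤ tailCount tes (tailPort t)
  1≤tailCount {tes} {t} t∈ = subst (_≤ tailCount tes (tailPort t)) (⟦⟧-yes (tailPort t ≟ₚ tailPort t) refl)
                                   (∈⇒≤∑ (λ t′ → ⟦ tailPort t′ ≟ₚ tailPort t ⟧) t∈)

  choice-tailLoad : (tes : List TaggedEdge) → (∀ κ → tailCount tes κ ≤ 1) →
    (S : Choice tes) → choice tes (λ t → toBool (tailLoad tes S (tailPort t))) ≡ S
  choice-tailLoad []        _      []      = refl
  choice-tailLoad (t ∷ tes) unique (s ∷ S) = cong₂ _∷_ first rest
    where
    self : ⟦ tailPort t ≟ₚ tailPort t ⟧ ≡ 1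
    self = ⟦⟧-yes (tailPort t ≟ₚ tailPort t) refl
    no-other : tailCount tes (tailPort t) ≡ 0
    no-other = n≤0⇒n≡0 (+-cancelˡ-≤ 1 _ _
                 (subst (λ z → z + tailCount tes (tailPort t) ≤ 1) self (unique (tailPort t))))
    no-load : tailLoad tes S (tailPort t) ≡ 0
    no-load = n≤0⇒n≡0 (subst (tailLoad tes S (tailPort t) ≤_) no-other (∑chosen≤∑ tes S _))
    first : toBool (fromBool s * ⟦ tailPort t ≟ₚ tailPort t ⟧ + tailLoad tes S (tailPort t)) ≡ s
    first rewrite self | no-load | *-identityʳ (fromBool s) | +-identityʳ (fromBool s) = toBool-fromBool s
    distinct : ∀ t′ → t′ ∈ tes → ⟦ tailPort t ≟ₚ tailPort t′ ⟧ ≡ 0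
    distinct t′ t′∈ = ⟦⟧-no (tailPort t ≟ₚ tailPort t′) λ eq →
      1+n≰n (subst (1 ≤_) no-other (subst (λ κ → 1 ≤ tailCount tes κ) (sym eq) (1≤tailCount t′∈)))
    unique′ : ∀ κ → tailCount tes κ ≤ 1
    unique′ κ = ≤-trans (m≤n+m _ ⟦ tailPort t ≟ₚ κ ⟧) (unique κ)
    rest : choice tes (λ t′ → toBool (fromBool s * ⟦ tailPort t ≟ₚ tailPort t′ ⟧ + tailLoad tes S (tailPort t′)))
           ≡ S
    rest = trans (choice-cong tes λ t′ t′∈ → cong toBool
                   (trans (cong (λ z → fromBool s * z + tailLoad tes S (tailPort t′)) (distinct t′ t′∈))
                          (cong (_+ tailLoad tes S (tailPort t′)) (*-zeroʳ (fromBool s)))))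
                 (choice-tailLoad tes unique′ S)

-- Every vertex has its down-end on an edge to the up-end of the vertex below, at most one right-end and
-- at most one left-end; "above v" and "leftOf v" name the vertices whose down-end, resp. right-end, meets v.
module GridPortGraph (m n : ℕ) (above : Vtx m n → Vtx m n) (leftOf : Vtx m n → Maybe (Vtx m n))
                     (hasRight : Vtx m n → ℕ) (hasRight≤1 : ∀ v → hasRight v ≤ 1) where

  open PortGraph m n

  owns : Port → ℕ
  owns (v , up)    = 0
  owns (v , down)  = 1
  owns (v , left)  = 0
  owns (v , right) = hasRight v

  owns≤1 : ∀ κ → owns κ ≤ 1
  owns≤1 (v , up)    = z≤n
  owns≤1 (v , down)  = s≤s z≤n
  owns≤1 (v , left)  = z≤n
  owns≤1 (v , right) = hasRight≤1 v

  partner : Port → Maybe Port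
  partner (v , up)    = just (above v , down)
  partner (v , down)  = nothing
  partner (v , left)  = Data.Maybe.map (_, right) (leftOf v)
  partner (v , right) = nothing

  letterAt : Columns m n → Vtx m n → Letter
  letterAt Y (i , j) = lookup (lookup Y j) i

  uses : Columns m n → Port → Bool
  uses Y (v , δ) = has (letterAt Y v) δ

  partnerUse : Columns m n → Maybe Port → ℕ
  partnerUse Y nothing  = 0
  partnerUse Y (just κ) = owns κ * fromBool (uses Y κ)

  -- Choosing an edge exactly when its tail port is used, a port is used iff it carries a chosen edge-end.
  Consistent : Columns m n → Port → Set
  Consistent Y κ = fromBool (uses Y κ) ≡ owns κ * fromBool (uses Y κ) + partnerUse Y (partner κ)

  Compatible : Columns m n → Set
  Compatible Y = All (λ v → All (λ δ → Consistent Y (v , δ)) allDirs) (allVtx m n)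

  compatible? : (Y : Columns m n) → Dec (Compatible Y)
  compatible? Y = all? (λ v → all? (λ δ → fromBool (uses Y (v , δ)) ℕ.≟ _) allDirs) (allVtx m n)

  ∈-allVtx : ∀ v → v ∈ allVtx m n
  ∈-allVtx (i , j) = ∈-cartesianProduct⁺ (∈-allFin i) (∈-allFin j)

  Compatible⇒Consistent : ∀ {Y} → Compatible Y → ∀ v δ → Consistent Y (v , δ)
  Compatible⇒Consistent compat v δ = All-lookup (All-lookup compat (∈-allVtx v)) (∈-allDirs δ)

  Consistent⇒Compatible : ∀ {Y} → (∀ v δ → Consistent Y (v , δ)) → Compatible Y
  Consistent⇒Compatible consistent = All-tabulate (λ {v} _ → All-tabulate (λ {δ} _ → consistent v δ))

  module TwoFactors (tes : List TaggedEdge) (tails : ∀ κ → tailCount tes κ ≡ owns κ)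
    (heads : ∀ t → t ∈ tes → ∀ κ → (headPort t ≡ κ → partner κ ≡ just (tailPort t))
                                  × (partner κ ≡ just (tailPort t) → headPort t ≡ κ)) where

    partnerLoad : Choice tes → Maybe Port → ℕ
    partnerLoad S nothing  = 0
    partnerLoad S (just κ) = tailLoad tes S κ

    headLoad-partner : ∀ S κ → headLoad tes S κ ≡ partnerLoad S (partner κ)
    headLoad-partner S κ with partner κ in eq
    ... | nothing = trans (∑chosen-cong-∈ tes S λ t t∈ → ⟦⟧-no (headPort t ≟ₚ κ) λ h≡κ →
                            nothing≢just (trans (sym eq) (proj₁ (heads t t∈ κ) h≡κ)))
                          (∑chosen-zero tes S)
      where
      nothing≢just : ∀ {κ′} → nothing ≢ just κ′
      nothing≢just ()
    ... | just κ′ = ∑chosen-cong-∈ tes S λ t t∈ → ⟦⟧-⇔ (headPort t ≟ₚ κ) (tailPort t ≟ₚ κ′)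
                      (λ h≡κ → sym (just-injective (trans (sym eq) (proj₁ (heads t t∈ κ) h≡κ))))
                      (λ t≡κ′ → proj₂ (heads t t∈ κ) (trans eq (cong just (sym t≡κ′))))

    portLoad : Choice tes → Port → ℕ
    portLoad S κ = tailLoad tes S κ + partnerLoad S (partner κ)

    chosenDeg-portLoad : ∀ S v → chosenDeg (map proj₂ tes) S v ≡ ∑[ δ ∈ allDirs ] portLoad S (v , δ)
    chosenDeg-portLoad S v = trans (chosenDeg-loads tes S v)
      (∑-cong allDirs (λ δ → cong (tailLoad tes S (v , δ) +_) (headLoad-partner S (v , δ))))

    tailLoad≤owns : ∀ S κ → tailLoad tes S κ ≤ owns κ
    tailLoad≤owns S κ = subst (tailLoad tes S κ ≤_) (tails κ) (∑chosen≤∑ tes S _)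

    tailLoad≤1 : ∀ S κ → tailLoad tes S κ ≤ 1
    tailLoad≤1 S κ = ≤-trans (tailLoad≤owns S κ) (owns≤1 κ)

    tailLoad-up : ∀ S v → tailLoad tes S (v , up) ≡ 0
    tailLoad-up S v = n≤0⇒n≡0 (tailLoad≤owns S (v , up))

    tailLoad-left : ∀ S v → tailLoad tes S (v , left) ≡ 0
    tailLoad-left S v = n≤0⇒n≡0 (tailLoad≤owns S (v , left))

    owns*tailLoad : ∀ S κ → owns κ * tailLoad tes S κ ≡ tailLoad tes S κ
    owns*tailLoad S κ with owns κ | tailLoad≤owns S κ | owns≤1 κ
    ... | zero        | load≤0 | _ = sym (n≤0⇒n≡0 load≤0)
    ... | suc zero    | _      | _ = +-identityʳ _
    ... | suc (suc _) | _      | s≤s ()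

    portLoad≤1 : ∀ S κ → portLoad S κ ≤ 1
    portLoad≤1 S (v , up)    rewrite tailLoad-up S v = tailLoad≤1 S (above v , down)
    portLoad≤1 S (v , down)  = ≤-trans (≤-reflexive (+-identityʳ _)) (tailLoad≤1 S (v , down))
    portLoad≤1 S (v , left)  rewrite tailLoad-left S v with leftOf v
    ... | nothing = z≤n
    ... | just w  = tailLoad≤1 S (w , right)
    portLoad≤1 S (v , right) = ≤-trans (≤-reflexive (+-identityʳ _)) (tailLoad≤1 S (v , right))

    edgesOf : Columns m n → Choice tes
    edgesOf Y = choice tes (λ t → uses Y (tailPort t))

    portBits : Choice tes → Vtx m n → Dir → Bool
    portBits S v δ = toBool (portLoad S (v , δ))

    lettersOf : Choice tes → Columns m n
    lettersOf S = tabulateᵛ λ j → tabulateᵛ λ i → letterOfBits (portBits S (i , j))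

    letterAt-lettersOf : ∀ S v → letterAt (lettersOf S) v ≡ letterOfBits (portBits S v)
    letterAt-lettersOf S (i , j) =
      trans (cong (λ col → lookup col i) (Vecₚ.lookup∘tabulate _ j)) (Vecₚ.lookup∘tabulate _ i)

    tailLoad-edgesOf : ∀ Y κ → tailLoad tes (edgesOf Y) κ ≡ owns κ * fromBool (uses Y κ)
    tailLoad-edgesOf Y κ = begin
      tailLoad tes (edgesOf Y) κ
        ≡⟨ ∑chosen-choice tes (λ t → uses Y (tailPort t)) _ ⟩
      ∑[ t ∈ tes ] (fromBool (uses Y (tailPort t)) * ⟦ tailPort t ≟ₚ κ ⟧)
        ≡⟨ ∑-cong tes (λ t → *-comm (fromBool (uses Y (tailPort t))) _) ⟩
      ∑[ t ∈ tes ] (⟦ tailPort t ≟ₚ κ ⟧ * fromBool (uses Y (tailPort t)))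
        ≡⟨ sym (∑-map tailPort tes (λ κ′ → ⟦ κ′ ≟ₚ κ ⟧ * fromBool (uses Y κ′))) ⟩
      ∑[ κ′ ∈ map tailPort tes ] (⟦ κ′ ≟ₚ κ ⟧ * fromBool (uses Y κ′))
        ≡⟨ ∑-⟦≟⟧-* _≟ₚ_ (map tailPort tes) κ (λ κ′ → fromBool (uses Y κ′)) ⟩
      count _≟ₚ_ (map tailPort tes) κ * fromBool (uses Y κ)
        ≡⟨ cong (_* fromBool (uses Y κ)) (trans (∑-map tailPort tes _) (tails κ)) ⟩
      owns κ * fromBool (uses Y κ) ∎
      where open ≡-Reasoning

    portLoad-edgesOf : ∀ Y → Compatible Y → ∀ κ → portLoad (edgesOf Y) κ ≡ fromBool (uses Y κ)
    portLoad-edgesOf Y compat (v , δ) = trans (cong₂ _+_ (tailLoad-edgesOf Y (v , δ)) (partner-edgesOf (partner (v , δ))))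
                                              (sym (Compatible⇒Consistent compat v δ))
      where
      partner-edgesOf : ∀ mκ → partnerLoad (edgesOf Y) mκ ≡ partnerUse Y mκ
      partner-edgesOf nothing  = refl
      partner-edgesOf (just κ) = tailLoad-edgesOf Y κ

    edgesOf-twoFactor : ∀ Y → Compatible Y → IsTwoFactor (map proj₂ tes) (edgesOf Y)
    edgesOf-twoFactor Y compat = All-tabulate λ {v} _ →
      trans (chosenDeg-portLoad (edgesOf Y) v)
        (trans (∑-cong allDirs (λ δ → portLoad-edgesOf Y compat (v , δ))) (∑-allDirs-has (letterAt Y v)))

    letterAt-injective : ∀ {Y Y′} → (∀ v → letterAt Y v ≡ letterAt Y′ v) → Y ≡ Y′
    letterAt-injective {Y} {Y′} same = ≗-lookup⇒≡ Y Y′ λ j → ≗-lookup⇒≡ _ _ λ i → same (i , j)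

    lettersOf-edgesOf : ∀ Y → Compatible Y → lettersOf (edgesOf Y) ≡ Y
    lettersOf-edgesOf Y compat = letterAt-injective λ v →
      trans (letterAt-lettersOf (edgesOf Y) v) (trans (letterOfBits-cong (bits≡ v)) (letterOf-has (letterAt Y v)))
      where
      bits≡ : ∀ v δ → portBits (edgesOf Y) v δ ≡ has (letterAt Y v) δ
      bits≡ v δ = trans (cong toBool (portLoad-edgesOf Y compat (v , δ))) (toBool-fromBool _)

    module _ (S : Choice tes) (twoFactor : IsTwoFactor (map proj₂ tes) S) where

      uses-lettersOf : ∀ κ → uses (lettersOf S) κ ≡ toBool (portLoad S κ)
      uses-lettersOf (v , δ) =
        trans (cong (λ ℓ → has ℓ δ) (letterAt-lettersOf S v))
          (has-letterOfBits (portBits S v) degree-two δ)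
        where
        degree-two : ∑[ δ′ ∈ allDirs ] fromBool (toBool (portLoad S (v , δ′))) ≡ 2
        degree-two = trans (∑-cong allDirs (λ δ′ → fromBool-toBool _ (portLoad≤1 S (v , δ′))))
                           (trans (sym (chosenDeg-portLoad S v)) (All-lookup twoFactor (∈-allVtx v)))

      use-lettersOf : ∀ κ → fromBool (uses (lettersOf S) κ) ≡ portLoad S κ
      use-lettersOf κ = trans (cong fromBool (uses-lettersOf κ)) (fromBool-toBool _ (portLoad≤1 S κ))

      owned-use-lettersOf : ∀ κ → partner κ ≡ nothing → owns κ * fromBool (uses (lettersOf S) κ) ≡ tailLoad tes S κ
      owned-use-lettersOf κ no-partner =
        trans (cong (owns κ *_) (trans (use-lettersOf κ) (cong (λ p → tailLoad tes S κ + partnerLoad S p) no-partner)))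
          (trans (cong (owns κ *_) (+-identityʳ _)) (owns*tailLoad S κ))

      lettersOf-compatible : Compatible (lettersOf S)
      lettersOf-compatible = Consistent⇒Compatible consistent
        where
        consistent : ∀ v δ → Consistent (lettersOf S) (v , δ)
        consistent v up = begin
          fromBool (uses (lettersOf S) (v , up))
            ≡⟨ use-lettersOf (v , up) ⟩
          tailLoad tes S (v , up) + tailLoad tes S (above v , down)
            ≡⟨ cong (_+ tailLoad tes S (above v , down)) (tailLoad-up S v) ⟩
          tailLoad tes S (above v , down)
            ≡⟨ sym (owned-use-lettersOf (above v , down) refl) ⟩
          1 * fromBool (uses (lettersOf S) (above v , down)) ∎
          where open ≡-Reasoning
        consistent v down = sym (trans (+-identityʳ _) (*-identityˡ _))
        consistent v left = trans (use-lettersOf (v , left))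
          (trans (cong (_+ partnerLoad S (partner (v , left))) (tailLoad-left S v)) (from-left (leftOf v)))
          where
          from-left : ∀ mw → partnerLoad S (Data.Maybe.map (_, right) mw)
                             ≡ partnerUse (lettersOf S) (Data.Maybe.map (_, right) mw)
          from-left nothing  = refl
          from-left (just w) = sym (owned-use-lettersOf (w , right) refl)
        consistent v right = trans (use-lettersOf (v , right))
          (trans (+-identityʳ _) (sym (trans (+-identityʳ _) (owned-use-lettersOf (v , right) refl))))

      partner-tailPort : ∀ t → t ∈ tes → partner (tailPort t) ≡ nothing
      partner-tailPort (up    , (x , _)) t∈ = ⊥-elim (1+n≰n (subst (1 ≤_) (tails (x , up)) (1≤tailCount t∈)))
      partner-tailPort (down  , _)       _  = refl
      partner-tailPort (left  , (x , _)) t∈ = ⊥-elim (1+n≰n (subst (1 ≤_) (tails (x , left)) (1≤tailCount t∈)))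
      partner-tailPort (right , _)       _  = refl

      edgesOf-lettersOf : edgesOf (lettersOf S) ≡ S
      edgesOf-lettersOf =
        trans (choice-cong tes λ t t∈ → trans (uses-lettersOf (tailPort t)) (cong toBool
                 (trans (cong (λ p → tailLoad tes S (tailPort t) + partnerLoad S p) (partner-tailPort t t∈))
                        (+-identityʳ _))))
          (choice-tailLoad tes (λ κ → subst (_≤ 1) (sym (tails κ)) (owns≤1 κ)) S)

    #twoFactors≡#compatible : numTwoFactors (map proj₂ tes) ≡ ∑[ Y ∈ allColumnSeqs m n ] ⟦ compatible? Y ⟧
    #twoFactors≡#compatible =
      trans (length-filter (isTwoFactor? (map proj₂ tes)) (allVecs allBools (length (map proj₂ tes))))
        (sym (count-bijection (Vecₚ.≡-dec _≟ᶜ_) _≟W_ {allColumnSeqs m n} {allVecs allBools _}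
               compatible? (isTwoFactor? (map proj₂ tes)) edgesOf lettersOf
               (allColumnSeqs-enumerates m n) (allWords-enumerates _)
               edgesOf-twoFactor lettersOf-edgesOf lettersOf-compatible edgesOf-lettersOf))

-- Cyclic rows

lookup-∷ʳ-fromℕ : ∀ {A : Set} {k} (xs : Vec A k) x → lookup (xs ∷ʳ x) (fromℕ k) ≡ x
lookup-∷ʳ-fromℕ []       x = refl
lookup-∷ʳ-fromℕ (y ∷ xs) x = lookup-∷ʳ-fromℕ xs x

lookup-∷ʳ-inject₁ : ∀ {A : Set} {k} (xs : Vec A k) x (j : Fin k) → lookup (xs ∷ʳ x) (inject₁ j) ≡ lookup xs j
lookup-∷ʳ-inject₁ (y ∷ xs) x zero    = refl
lookup-∷ʳ-inject₁ (y ∷ xs) x (suc j) = lookup-∷ʳ-inject₁ xs x j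

opposite-fromℕ : ∀ n → opposite (fromℕ n) ≡ zero
opposite-fromℕ n =
  toℕ-injective (trans (opposite-prop (fromℕ n)) (trans (cong (λ z → suc n ∸ suc z) (toℕ-fromℕ n)) (n∸n≡0 n)))

opposite-inject₁ : ∀ {n} (j : Fin n) → opposite (inject₁ j) ≡ suc (opposite j)
opposite-inject₁ {n} j = toℕ-injective (trans (opposite-prop (inject₁ j))
  (trans (cong (λ z → suc n ∸ suc z) (toℕ-inject₁ j)) (trans (+-∸-assoc 1 (toℕ<n j)) (cong suc (sym (opposite-prop j))))))

lookup-reverse : ∀ {A : Set} {n} (v : Vec A n) (r : Fin n) → lookup (reverse v) r ≡ lookup v (opposite r)
lookup-reverse {n = suc n} (x ∷ xs) r with view r
... | ‵fromℕ =
  trans (cong (λ z → lookup z (fromℕ n)) (Vecₚ.reverse-∷ x xs))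
    (trans (lookup-∷ʳ-fromℕ (reverse xs) x) (cong (lookup (x ∷ xs)) (sym (opposite-fromℕ n))))
... | ‵inj₁ {i = j} _ =
  trans (cong (λ z → lookup z (inject₁ j)) (Vecₚ.reverse-∷ x xs))
    (trans (lookup-∷ʳ-inject₁ (reverse xs) x j)
      (trans (lookup-reverse xs j) (cong (lookup (x ∷ xs)) (sym (opposite-inject₁ j)))))

module CyclicRows (k : ℕ) where

  M : ℕ
  M = suc k

  toℕ-mod : ∀ x → toℕ (x mod M) ≡ x % M
  toℕ-mod x = toℕ-fromℕ< (m%n<n x M)

  toℕ%M : ∀ (i : Fin M) → toℕ i % M ≡ toℕ i
  toℕ%M i = m<n⇒m%n≡m (toℕ<n i)

  +-%M : ∀ x y → (x + y % M) % M ≡ (x + y) % M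
  +-%M x y = trans (%-distribˡ-+ x (y % M) M)
               (trans (cong (λ z → (x % M + z) % M) (m%n%n≡m%n y M)) (sym (%-distribˡ-+ x y M)))

  next : Fin M → Fin M
  next = nextPos

  toℕ-next : ∀ i → toℕ (next i) ≡ suc (toℕ i) % M
  toℕ-next i = toℕ-mod (suc (toℕ i))

  prev : Fin M → Fin M
  prev r = (toℕ r + k) mod M

  next-prev : ∀ r → next (prev r) ≡ r
  next-prev r = toℕ-injective (begin
    toℕ (next (prev r))            ≡⟨ toℕ-next (prev r) ⟩
    suc (toℕ (prev r)) % M         ≡⟨ cong (λ z → suc z % M) (toℕ-mod (toℕ r + k)) ⟩
    (1 + (toℕ r + k) % M) % M      ≡⟨ +-%M 1 (toℕ r + k) ⟩
    (1 + (toℕ r + k)) % M          ≡⟨ cong (_% M) (sym (+-suc (toℕ r) k)) ⟩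
    (toℕ r + M) % M                ≡⟨ [m+n]%n≡m%n (toℕ r) M ⟩
    toℕ r % M                      ≡⟨ toℕ%M r ⟩
    toℕ r                          ∎)
    where open ≡-Reasoning

  prev-next : ∀ i → prev (next i) ≡ i
  prev-next i = toℕ-injective (begin
    toℕ (prev (next i))            ≡⟨ toℕ-mod (toℕ (next i) + k) ⟩
    (toℕ (next i) + k) % M         ≡⟨ cong (λ z → (z + k) % M) (toℕ-next i) ⟩
    (suc (toℕ i) % M + k) % M      ≡⟨ cong (_% M) (+-comm (suc (toℕ i) % M) k) ⟩
    (k + suc (toℕ i) % M) % M      ≡⟨ +-%M k (suc (toℕ i)) ⟩
    (k + suc (toℕ i)) % M          ≡⟨ cong (_% M) (trans (+-suc k (toℕ i)) (cong suc (+-comm k (toℕ i)))) ⟩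
    suc (toℕ i + k) % M            ≡⟨ cong (_% M) (sym (+-suc (toℕ i) k)) ⟩
    (toℕ i + M) % M                ≡⟨ [m+n]%n≡m%n (toℕ i) M ⟩
    toℕ i % M                      ≡⟨ toℕ%M i ⟩
    toℕ i                          ∎)
    where open ≡-Reasoning

  next^ : ℕ → Fin M → Fin M
  next^ zero    r = r
  next^ (suc p) r = next (next^ p r)

  prev^ : ℕ → Fin M → Fin M
  prev^ zero    r = r
  prev^ (suc p) r = prev^ p (prev r)

  next^-prev^ : ∀ p r → next^ p (prev^ p r) ≡ r
  next^-prev^ zero    r = refl
  next^-prev^ (suc p) r = trans (cong next (next^-prev^ p (prev r))) (next-prev r)

  prev^-next^ : ∀ p i → prev^ p (next^ p i) ≡ i
  prev^-next^ zero    i = refl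
  prev^-next^ (suc p) i = trans (cong (prev^ p) (prev-next (next^ p i))) (prev^-next^ p i)

  toℕ-next^ : ∀ p r → toℕ (next^ p r) ≡ (toℕ r + p) % M
  toℕ-next^ zero    r = sym (trans (cong (_% M) (+-identityʳ (toℕ r))) (toℕ%M r))
  toℕ-next^ (suc p) r =
    trans (toℕ-next (next^ p r)) (trans (cong (λ z → suc z % M) (toℕ-next^ p r))
      (trans (+-%M 1 (toℕ r + p)) (cong (_% M) (sym (+-suc (toℕ r) p)))))

  row-below : ∀ (i : Fin M) → row M (toℕ i + 2) ≡ next i
  row-below i = cong (_mod M) (trans (cong (_∸ 1) (+-suc (toℕ i) 1)) (+-comm (toℕ i) 1))

  row-TG : ∀ p i → row M (toℕ i + 1 + p) ≡ next^ p i
  row-TG p i = toℕ-injective (trans (toℕ-mod (toℕ i + 1 + p ∸ 1))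
    (trans (cong (λ z → (z + p ∸ 1) % M) (+-comm (toℕ i) 1)) (sym (toℕ-next^ p i))))

  row-KB : ∀ p i → row M (M + p + 1 ∸ (toℕ i + 1)) ≡ next^ p (opposite i)
  row-KB p i = toℕ-injective (trans (toℕ-mod (M + p + 1 ∸ (toℕ i + 1) ∸ 1))
    (trans (cong (_% M) arithmetic) (sym (toℕ-next^ p (opposite i)))))
    where
    i≤k : toℕ i ≤ k
    i≤k = ℕ.s≤s⁻¹ (toℕ<n i)
    cancel : ∀ x y → suc (x + y) + p + 1 ∸ (x + 1) ∸ 1 ≡ y + p
    cancel zero    y = m+n∸n≡m (y + p) 1
    cancel (suc x) y = cancel x y
    arithmetic : M + p + 1 ∸ (toℕ i + 1) ∸ 1 ≡ toℕ (opposite i) + p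
    arithmetic = trans (cong (λ z → suc z + p + 1 ∸ (toℕ i + 1) ∸ 1) (sym (m+[n∸m]≡n i≤k)))
                   (trans (cancel (toℕ i) (k ∸ toℕ i)) (cong (_+ p) (sym (opposite-prop i))))

  lookup-ρ : (w : Vec Bool M) (r : Fin M) → lookup (ρ w) r ≡ lookup w (next r)
  lookup-ρ (x ∷ xs) r with view r
  ... | ‵fromℕ = trans (lookup-∷ʳ-fromℕ xs x) (cong (lookup (x ∷ xs)) (sym next-last))
    where
    next-last : next (fromℕ k) ≡ zero
    next-last = toℕ-injective (trans (toℕ-next (fromℕ k)) (trans (cong (λ z → suc z % M) (toℕ-fromℕ k)) (n%n≡0 M)))
  ... | ‵inj₁ {i = j} _ = trans (lookup-∷ʳ-inject₁ xs x j) (cong (lookup (x ∷ xs)) (sym next-inject₁))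
    where
    next-inject₁ : next (inject₁ j) ≡ suc j
    next-inject₁ = toℕ-injective (trans (toℕ-next (inject₁ j))
      (trans (cong (λ z → suc z % M) (toℕ-inject₁ j)) (m<n⇒m%n≡m (s≤s (toℕ<n j)))))

  lookup-ρ^ : ∀ p (w : Vec Bool M) (r : Fin M) → lookup (ρ^ p w) r ≡ lookup w (next^ p r)
  lookup-ρ^ zero    w r = refl
  lookup-ρ^ (suc p) w r = trans (lookup-ρ^ p (ρ w) r) (lookup-ρ w (next^ p r))

-- The grids TnC, TG and KB

∑-allFin-suc : ∀ n (g : Fin (suc n) → ℕ) → ∑ (allFin (suc n)) g ≡ g zero + ∑[ j ∈ allFin n ] g (suc j)
∑-allFin-suc n g =
  cong (g zero +_) (cong sum (trans (map-tabulate suc g) (sym (map-tabulate (λ j → j) (λ j → g (suc j))))))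

⟦suc≟suc⟧ : ∀ {n} (i j : Fin n) → ⟦ Fin.suc i Fin.≟ suc j ⟧ ≡ ⟦ i Fin.≟ j ⟧
⟦suc≟suc⟧ i j = ⟦⟧-⇔ (suc i Fin.≟ suc j) (i Fin.≟ j) fsuc-injective (cong suc)

⟦suc≟zero⟧ : ∀ {n} (i : Fin n) → ⟦ Fin.suc i Fin.≟ zero ⟧ ≡ 0
⟦suc≟zero⟧ i = ⟦⟧-no (suc i Fin.≟ zero) (λ ())

allFin-enumerates : ∀ n → Enumerates Fin._≟_ (allFin n)
allFin-enumerates (suc n) zero =
  trans (∑-allFin-suc n (λ y → ⟦ y Fin.≟ zero ⟧))
    (cong suc (trans (∑-cong (allFin n) ⟦suc≟zero⟧) (∑-zero (allFin n))))
allFin-enumerates (suc n) (suc i) =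
  trans (∑-allFin-suc n (λ y → ⟦ y Fin.≟ suc i ⟧))
    (trans (∑-cong (allFin n) (λ j → ⟦suc≟suc⟧ j i)) (allFin-enumerates n i))

inner+last≡1 : ∀ n (col : Fin (suc n)) → ∑[ j ∈ allFin n ] ⟦ inject₁ j Fin.≟ col ⟧ + ⟦ fromℕ n Fin.≟ col ⟧ ≡ 1
inner+last≡1 zero    zero    = refl
inner+last≡1 (suc n) zero    =
  cong (_+ 0) (trans (∑-allFin-suc n (λ j → ⟦ inject₁ j Fin.≟ zero ⟧))
    (cong suc (trans (∑-cong (allFin n) (λ j → ⟦suc≟zero⟧ (inject₁ j))) (∑-zero (allFin n)))))
inner+last≡1 (suc n) (suc col) =
  trans (cong₂ _+_ (trans (∑-allFin-suc n (λ j → ⟦ inject₁ j Fin.≟ suc col ⟧))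
                          (∑-cong (allFin n) (λ j → ⟦suc≟suc⟧ (inject₁ j) col)))
                   (⟦suc≟suc⟧ (fromℕ n) col))
    (inner+last≡1 n col)

module Grid (k n′ : ℕ) (σ τ : Fin (suc k) → Fin (suc k)) (σ∘τ : ∀ r → σ (τ r) ≡ r) (τ∘σ : ∀ i → τ (σ i) ≡ i) where

  open CyclicRows k
  open PortGraph M (suc n′)

  lastCol : Fin (suc n′)
  lastCol = fromℕ n′

  vertical : Fin M × Fin (suc n′) → TaggedEdge
  vertical (i , j) = (down , ((i , j) , (row M (toℕ i + 2) , j)))

  horizontal : Fin M × Fin n′ → TaggedEdge
  horizontal (i , j) = (right , ((i , inject₁ j) , (i , suc j)))

  wrapping : Fin M → TaggedEdge
  wrapping i = (right , ((σ i , lastCol) , (i , zero)))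

  verticals : List TaggedEdge
  verticals = map vertical (cartesianProduct (allFin M) (allFin (suc n′)))

  horizontals : List TaggedEdge
  horizontals = map horizontal (cartesianProduct (allFin M) (allFin n′))

  wrappings : Bool → List TaggedEdge
  wrappings false = []
  wrappings true  = map wrapping (allFin M)

  taggedEdges : Bool → List TaggedEdge
  taggedEdges wraps = (verticals ++ horizontals) ++ wrappings wraps

  above : Vtx M (suc n′) → Vtx M (suc n′)
  above (r , col) = (prev r , col)

  leftOf : Bool → Vtx M (suc n′) → Maybe (Vtx M (suc n′))
  leftOf _     (r , suc j) = just (r , inject₁ j)
  leftOf false (r , zero)  = nothing
  leftOf true  (r , zero)  = just (σ r , lastCol)

  isInner : Fin (suc n′) → ℕ
  isInner col = ∑[ j ∈ allFin n′ ] ⟦ inject₁ j Fin.≟ col ⟧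

  wrapsAt : Bool → Fin (suc n′) → ℕ
  wrapsAt false col = 0
  wrapsAt true  col = ⟦ lastCol Fin.≟ col ⟧

  hasRight : Bool → Vtx M (suc n′) → ℕ
  hasRight wraps (r , col) = isInner col + wrapsAt wraps col

  hasRight≤1 : ∀ wraps v → hasRight wraps v ≤ 1
  hasRight≤1 true  (r , col) = ≤-reflexive (inner+last≡1 n′ col)
  hasRight≤1 false (r , col) =
    ≤-trans (≤-reflexive (+-identityʳ (isInner col))) (≤-trans (m≤m+n (isInner col) _) (≤-reflexive (inner+last≡1 n′ col)))

  module Ports (wraps : Bool) = GridPortGraph M (suc n′) above (leftOf wraps) (hasRight wraps) (hasRight≤1 wraps)

  ⟦port≟port⟧ : ∀ (i r : Fin M) (j col : Fin (suc n′)) (δ δ′ : Dir) →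
    ⟦ ((i , j) , δ) ≟ₚ ((r , col) , δ′) ⟧ ≡ ⟦ i Fin.≟ r ⟧ * (⟦ j Fin.≟ col ⟧ * ⟦ δ ≟ᴰ δ′ ⟧)
  ⟦port≟port⟧ i r j col δ δ′ =
    trans (⟦⟧-⇔ (((i , j) , δ) ≟ₚ ((r , col) , δ′)) ((i Fin.≟ r) ×-dec ((j Fin.≟ col) ×-dec (δ ≟ᴰ δ′)))
             (λ { refl → refl , refl , refl }) (λ { (refl , refl , refl) → refl }))
      (trans (⟦⟧-× (i Fin.≟ r) _) (cong (⟦ i Fin.≟ r ⟧ *_) (⟦⟧-× (j Fin.≟ col) (δ ≟ᴰ δ′))))

  pickRow : ∀ r (g : Fin M → ℕ) → ∑[ i ∈ allFin M ] (⟦ i Fin.≟ r ⟧ * g i) ≡ g r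
  pickRow = ∑-pick Fin._≟_ (allFin M) (allFin-enumerates M)

  tailCount-verticals : ∀ r col δ → tailCount verticals ((r , col) , δ) ≡ ⟦ down ≟ᴰ δ ⟧
  tailCount-verticals r col δ =
    trans (∑-map vertical (cartesianProduct (allFin M) (allFin (suc n′))) _)
      (trans (∑-cartesianProduct (allFin M) (allFin (suc n′)) _)
        (trans (∑-cong (allFin M) (λ i → trans (∑-cong (allFin (suc n′)) (λ j → ⟦port≟port⟧ i r j col down δ))
                                                (∑-*ˡ (allFin (suc n′)) ⟦ i Fin.≟ r ⟧ _)))
          (trans (pickRow r _) (∑-pick Fin._≟_ (allFin (suc n′)) (allFin-enumerates (suc n′)) col _))))

  tailCount-horizontals : ∀ r col δ → tailCount horizontals ((r , col) , δ) ≡ isInner col * ⟦ right ≟ᴰ δ ⟧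
  tailCount-horizontals r col δ =
    trans (∑-map horizontal (cartesianProduct (allFin M) (allFin n′)) _)
      (trans (∑-cartesianProduct (allFin M) (allFin n′) _)
        (trans (∑-cong (allFin M) (λ i → trans (∑-cong (allFin n′) (λ j → ⟦port≟port⟧ i r (inject₁ j) col right δ))
                                                (∑-*ˡ (allFin n′) ⟦ i Fin.≟ r ⟧ _)))
          (trans (pickRow r _) (∑-*ʳ (allFin n′) ⟦ right ≟ᴰ δ ⟧ (λ j → ⟦ inject₁ j Fin.≟ col ⟧)))))

  tailCount-wrappings : ∀ wraps r col δ → tailCount (wrappings wraps) ((r , col) , δ) ≡ wrapsAt wraps col * ⟦ right ≟ᴰ δ ⟧
  tailCount-wrappings false r col δ = refl
  tailCount-wrappings true  r col δ =
    trans (∑-map wrapping (allFin M) _)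
      (trans (∑-cong (allFin M) (λ i → trans (⟦port≟port⟧ (σ i) r lastCol col right δ)
                (cong (_* (⟦ lastCol Fin.≟ col ⟧ * ⟦ right ≟ᴰ δ ⟧))
                  (⟦⟧-⇔ (σ i Fin.≟ r) (i Fin.≟ τ r) (λ eq → trans (sym (τ∘σ i)) (cong τ eq))
                                                    (λ eq → trans (cong σ eq) (σ∘τ r))))))
        (pickRow (τ r) _))

  tailCount-taggedEdges : ∀ wraps κ → tailCount (taggedEdges wraps) κ ≡ Ports.owns wraps κ
  tailCount-taggedEdges wraps ((r , col) , δ) =
    trans (∑-++ (verticals ++ horizontals) (wrappings wraps) _)
      (trans (cong (_+ tailCount (wrappings wraps) ((r , col) , δ)) (∑-++ verticals horizontals _))
        (trans (cong₂ _+_ (cong₂ _+_ (tailCount-verticals r col δ) (tailCount-horizontals r col δ))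
                          (tailCount-wrappings wraps r col δ))
          (by-direction δ)))
    where
    by-direction : ∀ δ → ⟦ down ≟ᴰ δ ⟧ + isInner col * ⟦ right ≟ᴰ δ ⟧ + wrapsAt wraps col * ⟦ right ≟ᴰ δ ⟧
                         ≡ Ports.owns wraps ((r , col) , δ)
    by-direction up    rewrite *-zeroʳ (isInner col) | *-zeroʳ (wrapsAt wraps col) = refl
    by-direction down  rewrite *-zeroʳ (isInner col) | *-zeroʳ (wrapsAt wraps col) = refl
    by-direction left  rewrite *-zeroʳ (isInner col) | *-zeroʳ (wrapsAt wraps col) = refl
    by-direction right rewrite *-identityʳ (isInner col) | *-identityʳ (wrapsAt wraps col) = refl

  HeadsMeetPartners : Bool → TaggedEdge → Set
  HeadsMeetPartners wraps t = ∀ κ → (headPort t ≡ κ → Ports.partner wraps κ ≡ just (tailPort t))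
                                   × (Ports.partner wraps κ ≡ just (tailPort t) → headPort t ≡ κ)

  map-right≢down : ∀ (mw : Maybe (Vtx M (suc n′))) x → Data.Maybe.map (_, right) mw ≢ just (x , down)
  map-right≢down nothing  x ()
  map-right≢down (just w) x ()

  vertical-heads : ∀ wraps i j → HeadsMeetPartners wraps (vertical (i , j))
  vertical-heads wraps i j κ = forth κ , back i j κ
    where
    forth : ∀ κ → headPort (vertical (i , j)) ≡ κ → Ports.partner wraps κ ≡ just ((i , j) , down)
    forth _ refl = cong (λ r → just ((r , j) , down)) (trans (cong prev (row-below i)) (prev-next i))
    back : ∀ i j κ → Ports.partner wraps κ ≡ just ((i , j) , down) → headPort (vertical (i , j)) ≡ κ
    back .(prev r) .col ((r , col) , up) refl = cong (λ z → ((z , col) , up)) (trans (row-below (prev r)) (next-prev r))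
    back i j ((r , col) , down) ()
    back i j ((r , col) , left) eq = ⊥-elim (map-right≢down (leftOf wraps (r , col)) (i , j) eq)
    back i j ((r , col) , right) ()

  horizontal-heads : ∀ wraps i j → HeadsMeetPartners wraps (horizontal (i , j))
  horizontal-heads wraps i j κ = (λ { refl → refl }) , back wraps κ
    where
    back : ∀ wraps κ → Ports.partner wraps κ ≡ just ((i , inject₁ j) , right) → headPort (horizontal (i , j)) ≡ κ
    back _ ((r , col) , up) ()
    back _ ((r , col) , down) ()
    back false ((r , zero) , left) ()
    back true  ((r , zero) , left) eq = ⊥-elim (fromℕ≢inject₁ (cong (proj₂ ∘ proj₁) (just-injective eq)))
    back _ ((r , suc col′) , left) eq =
      cong₂ (λ x y → ((x , suc y) , left)) (sym (cong (proj₁ ∘ proj₁) (just-injective eq)))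
        (sym (inject₁-injective (cong (proj₂ ∘ proj₁) (just-injective eq))))
    back _ ((r , col) , right) ()

  wrapping-heads : ∀ i → HeadsMeetPartners true (wrapping i)
  wrapping-heads i κ = (λ { refl → refl }) , back κ
    where
    back : ∀ κ → Ports.partner true κ ≡ just ((σ i , lastCol) , right) → headPort (wrapping i) ≡ κ
    back ((r , col) , up) ()
    back ((r , col) , down) ()
    back ((r , zero) , left) eq =
      cong (λ x → ((x , zero) , left))
        (trans (sym (τ∘σ i)) (trans (cong τ (sym (cong (proj₁ ∘ proj₁) (just-injective eq)))) (τ∘σ r)))
    back ((r , suc col′) , left) eq = ⊥-elim (fromℕ≢inject₁ (sym (cong (proj₂ ∘ proj₁) (just-injective eq))))
    back ((r , col) , right) ()

  heads-taggedEdges : ∀ wraps t → t ∈ taggedEdges wraps → HeadsMeetPartners wraps t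
  heads-taggedEdges wraps t t∈ with ∈-++⁻ (verticals ++ horizontals) t∈
  ... | inj₂ t∈w with wraps
  ...   | true with ∈-map⁻ wrapping t∈w
  ...     | (i , _ , refl) = wrapping-heads i
  heads-taggedEdges wraps t t∈ | inj₁ t∈vh with ∈-++⁻ verticals t∈vh
  ... | inj₁ t∈v with ∈-map⁻ vertical t∈v
  ...   | ((i , j) , _ , refl) = vertical-heads wraps i j
  heads-taggedEdges wraps t t∈ | inj₁ t∈vh | inj₂ t∈h with ∈-map⁻ horizontal t∈h
  ... | ((i , j) , _ , refl) = horizontal-heads wraps i j

  isInner-inject₁ : ∀ j → isInner (inject₁ j) ≡ 1
  isInner-inject₁ j = trans (sym (+-identityʳ _))
    (trans (cong (isInner (inject₁ j) +_) (sym (⟦⟧-no (lastCol Fin.≟ inject₁ j) fromℕ≢inject₁))) (inner+last≡1 n′ (inject₁ j)))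

  isInner-lastCol : isInner lastCol ≡ 0
  isInner-lastCol = +-cancelʳ-≡ 1 (isInner lastCol) 0
    (trans (cong (isInner lastCol +_) (sym (⟦⟧-yes (lastCol Fin.≟ lastCol) refl))) (inner+last≡1 n′ lastCol))

  hasRight-inject₁ : ∀ wraps r j → hasRight wraps (r , inject₁ j) ≡ 1
  hasRight-inject₁ false r j = trans (+-identityʳ _) (isInner-inject₁ j)
  hasRight-inject₁ true  r j = inner+last≡1 n′ (inject₁ j)

  hasRight-wraps : ∀ v → hasRight true v ≡ 1
  hasRight-wraps (r , col) = inner+last≡1 n′ col

  hasRight-lastCol : ∀ r → hasRight false (r , lastCol) ≡ 0
  hasRight-lastCol r = trans (+-identityʳ _) isInner-lastCol

  open Ports false using (uses)

  VerticallyMatched : Columns M (suc n′) → Set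
  VerticallyMatched Y = ∀ r col → uses Y ((r , col) , up) ≡ uses Y ((prev r , col) , down)

  HorizontallyMatched : Columns M (suc n′) → Set
  HorizontallyMatched Y = ∀ r (j : Fin n′) → uses Y ((r , suc j) , left) ≡ uses Y ((r , inject₁ j) , right)

  BoundaryMatched : Bool → Columns M (suc n′) → Set
  BoundaryMatched false Y = (∀ r → uses Y ((r , zero) , left) ≡ false) × (∀ r → uses Y ((r , lastCol) , right) ≡ false)
  BoundaryMatched true  Y = ∀ r → uses Y ((r , zero) , left) ≡ uses Y ((σ r , lastCol) , right)

  Matched : Bool → Columns M (suc n′) → Set
  Matched wraps Y = VerticallyMatched Y × HorizontallyMatched Y × BoundaryMatched wraps Y

  Compatible⇒Matched : ∀ wraps Y → Ports.Compatible wraps Y → Matched wraps Y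
  Compatible⇒Matched wraps Y compat = verticalOK , horizontalOK , boundaryOK wraps compat
    where
    verticalOK : VerticallyMatched Y
    verticalOK r col = fromBool-injective _ _ (trans (Ports.Compatible⇒Consistent wraps compat (r , col) up) (+-identityʳ _))
    horizontalOK : HorizontallyMatched Y
    horizontalOK r j = fromBool-injective _ _ (trans (Ports.Compatible⇒Consistent wraps compat (r , suc j) left)
      (trans (cong (_* fromBool (uses Y ((r , inject₁ j) , right))) (hasRight-inject₁ wraps r j)) (+-identityʳ _)))
    boundaryOK : ∀ wraps → Ports.Compatible wraps Y → BoundaryMatched wraps Y
    boundaryOK false compat =
      (λ r → fromBool-injective _ false (Ports.Compatible⇒Consistent false compat (r , zero) left)) ,
      (λ r → fromBool-injective _ false (trans (Ports.Compatible⇒Consistent false compat (r , lastCol) right)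
               (trans (+-identityʳ _) (cong (_* fromBool (uses Y ((r , lastCol) , right))) (hasRight-lastCol r)))))
    boundaryOK true compat r = fromBool-injective _ _ (trans (Ports.Compatible⇒Consistent true compat (r , zero) left)
      (trans (cong (_* fromBool (uses Y ((σ r , lastCol) , right))) (hasRight-wraps (σ r , lastCol))) (+-identityʳ _)))

  Matched⇒Compatible : ∀ wraps Y → Matched wraps Y → Ports.Compatible wraps Y
  Matched⇒Compatible wraps Y (verticalOK , horizontalOK , boundaryOK) = Ports.Consistent⇒Compatible wraps consistent
    where
    consistent-right : ∀ wraps v → hasRight wraps v ≡ 1 → Ports.Consistent wraps Y (v , right)
    consistent-right _ v one =
      sym (trans (+-identityʳ _) (trans (cong (_* fromBool (uses Y (v , right))) one) (*-identityˡ _)))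
    consistent-left-zero : ∀ wraps → BoundaryMatched wraps Y → ∀ r → Ports.Consistent wraps Y ((r , zero) , left)
    consistent-left-zero false (no-left , _) r = cong fromBool (no-left r)
    consistent-left-zero true  matched       r = trans (cong fromBool (matched r))
      (sym (trans (cong (_* fromBool (uses Y ((σ r , lastCol) , right))) (hasRight-wraps (σ r , lastCol))) (+-identityʳ _)))
    consistent-right-last : ∀ wraps → BoundaryMatched wraps Y → ∀ r → Ports.Consistent wraps Y ((r , lastCol) , right)
    consistent-right-last false (_ , no-right) r = trans (cong fromBool (no-right r))
      (sym (trans (+-identityʳ _) (cong (_* fromBool (uses Y ((r , lastCol) , right))) (hasRight-lastCol r))))
    consistent-right-last true _ r = consistent-right true (r , lastCol) (hasRight-wraps (r , lastCol))
    consistent : ∀ v δ → Ports.Consistent wraps Y (v , δ)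
    consistent (r , col) up = trans (cong fromBool (verticalOK r col)) (sym (+-identityʳ _))
    consistent v down = sym (trans (+-identityʳ _) (+-identityʳ _))
    consistent (r , zero) left = consistent-left-zero wraps boundaryOK r
    consistent (r , suc j) left = trans (cong fromBool (horizontalOK r j))
      (sym (trans (cong (_* fromBool (uses Y ((r , inject₁ j) , right))) (hasRight-inject₁ wraps r j)) (+-identityʳ _)))
    consistent (r , col) right with view col
    ... | ‵fromℕ          = consistent-right-last wraps boundaryOK r
    ... | ‵inj₁ {i = j} _ = consistent-right wraps (r , inject₁ j) (hasRight-inject₁ wraps r j)

  VerticallyMatched⇔vertices : ∀ Y → (VerticallyMatched Y → ∀ col → IsDmVertex (lookup Y col))
                                    × ((∀ col → IsDmVertex (lookup Y col)) → VerticallyMatched Y)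
  VerticallyMatched⇔vertices Y =
    (λ matched col i → sym (trans (matched (next i) col) (cong (λ r → has (lookup (lookup Y col) r) down) (prev-next i)))) ,
    (λ vertices r col → sym (trans (vertices col (prev r)) (cong (λ r′ → has (lookup (lookup Y col) r′) up) (next-prev r))))

  HorizontallyMatched⇔Chained : ∀ Y → (HorizontallyMatched Y → Chained Y) × (Chained Y → HorizontallyMatched Y)
  HorizontallyMatched⇔Chained Y =
    (λ matched j → ≗-lookup⇒≡ _ _ λ r →
       trans (lookup-inlet (lookup Y (suc j)) r) (trans (matched r j) (sym (lookup-outlet (lookup Y (inject₁ j)) r)))) ,
    (λ chained r j → trans (sym (lookup-inlet (lookup Y (suc j)) r))
       (trans (cong (λ w → lookup w r) (chained j)) (lookup-outlet (lookup Y (inject₁ j)) r)))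

  module _ (B : Word M → Word M) (lookup-B : ∀ w r → lookup (B w) r ≡ lookup w (σ r)) where

    entry≡B[exit] : Columns M (suc n′) → Set
    entry≡B[exit] Y = inlet (lookup Y zero) ≡ B (outlet (lastColumn Y))

    lookup-B-exit : ∀ Y r → lookup (B (outlet (lastColumn Y))) r ≡ uses Y ((σ r , lastCol) , right)
    lookup-B-exit Y r = trans (lookup-B _ r) (lookup-outlet (lastColumn Y) (σ r))

    BoundaryMatched⇔twisted : ∀ Y → (BoundaryMatched true Y → entry≡B[exit] Y) × (entry≡B[exit] Y → BoundaryMatched true Y)
    BoundaryMatched⇔twisted Y =
      (λ matched → ≗-lookup⇒≡ _ _ λ r → trans (lookup-inlet (lookup Y zero) r) (trans (matched r) (sym (lookup-B-exit Y r)))) ,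
      (λ twisted r → trans (sym (lookup-inlet (lookup Y zero) r)) (trans (cong (λ w → lookup w r) twisted) (lookup-B-exit Y r)))

    Compatible⇒TwistedClosedWalk : ∀ Y → Ports.Compatible true Y → TwistedClosedWalk B Y
    Compatible⇒TwistedClosedWalk Y compat with Compatible⇒Matched true Y compat
    ... | verticalOK , horizontalOK , boundaryOK =
      columns⇒IsWalk _ Y _ (proj₁ (VerticallyMatched⇔vertices Y) verticalOK) (proj₁ (BoundaryMatched⇔twisted Y) boundaryOK)
        (proj₁ (HorizontallyMatched⇔Chained Y) horizontalOK) refl

    TwistedClosedWalk⇒Compatible : ∀ Y → TwistedClosedWalk B Y → Ports.Compatible true Y
    TwistedClosedWalk⇒Compatible Y walk with IsWalk⇒columns _ Y _ walk
    ... | vertices , entry , chained , _ =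
      Matched⇒Compatible true Y (proj₂ (VerticallyMatched⇔vertices Y) vertices ,
        proj₂ (HorizontallyMatched⇔Chained Y) chained , proj₂ (BoundaryMatched⇔twisted Y) entry)

  lookup-zeroWord : ∀ r → lookup (zeroWord M) r ≡ false
  lookup-zeroWord r = Vecₚ.lookup-replicate r false

  Compatible⇒zeroWalk : ∀ Y → Ports.Compatible false Y → IsWalk (zeroWord M) Y (zeroWord M)
  Compatible⇒zeroWalk Y compat with Compatible⇒Matched false Y compat
  ... | verticalOK , horizontalOK , no-left , no-right =
    columns⇒IsWalk _ Y _ (proj₁ (VerticallyMatched⇔vertices Y) verticalOK)
      (≗-lookup⇒≡ _ _ λ r → trans (lookup-inlet (lookup Y zero) r) (trans (no-left r) (sym (lookup-zeroWord r))))
      (proj₁ (HorizontallyMatched⇔Chained Y) horizontalOK)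
      (≗-lookup⇒≡ _ _ λ r → trans (lookup-outlet (lastColumn Y) r) (trans (no-right r) (sym (lookup-zeroWord r))))

  zeroWalk⇒Compatible : ∀ Y → IsWalk (zeroWord M) Y (zeroWord M) → Ports.Compatible false Y
  zeroWalk⇒Compatible Y walk with IsWalk⇒columns _ Y _ walk
  ... | vertices , entry , chained , exit =
    Matched⇒Compatible false Y (proj₂ (VerticallyMatched⇔vertices Y) vertices ,
      proj₂ (HorizontallyMatched⇔Chained Y) chained ,
      (λ r → trans (sym (lookup-inlet (lookup Y zero) r)) (trans (cong (λ w → lookup w r) entry) (lookup-zeroWord r))) ,
      (λ r → trans (sym (lookup-outlet (lastColumn Y) r)) (trans (cong (λ w → lookup w r) exit) (lookup-zeroWord r))))

  #twoFactors≡#compatible : ∀ wraps →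
    numTwoFactors (map proj₂ (taggedEdges wraps)) ≡ ∑[ Y ∈ allColumnSeqs M (suc n′) ] ⟦ Ports.compatible? wraps Y ⟧
  #twoFactors≡#compatible wraps =
    Ports.TwoFactors.#twoFactors≡#compatible wraps (taggedEdges wraps) (tailCount-taggedEdges wraps) (heads-taggedEdges wraps)

  #twoFactors-wrapped : (B : Word M → Word M) → (∀ w r → lookup (B w) r ≡ lookup w (σ r)) →
    numTwoFactors (map proj₂ (taggedEdges true)) ≡ ∑[ u ∈ VStar M ] (TStar M ^M suc n′) (B u) u
  #twoFactors-wrapped B lookup-B =
    trans (#twoFactors≡#compatible true)
      (trans (∑-cong (allColumnSeqs M (suc n′)) (λ Y → ⟦⟧-⇔ (Ports.compatible? true Y) (twistedClosedWalk? B Y)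
                (Compatible⇒TwistedClosedWalk B lookup-B Y) (TwistedClosedWalk⇒Compatible B lookup-B Y)))
        (sym (∑-TStar^-twisted n′ B)))

  #twoFactors-open : numTwoFactors (map proj₂ (taggedEdges false)) ≡ (TStar M ^M suc n′) (zeroWord M) (zeroWord M)
  #twoFactors-open =
    trans (#twoFactors≡#compatible false)
      (trans (∑-cong (allColumnSeqs M (suc n′)) (λ Y → ⟦⟧-⇔ (Ports.compatible? false Y) (isWalk? _ Y _)
                (Compatible⇒zeroWalk Y) (zeroWalk⇒Compatible Y)))
        (sym (TStar^-walks (suc n′) (zeroWord M) (zeroWord M))))

  TnCEdges-untagged : TnCEdges M (suc n′) ≡ map proj₂ (taggedEdges false)
  TnCEdges-untagged = sym (trans (cong (map proj₂) (++-identityʳ (verticals ++ horizontals))) grid-untagged)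
    where
    grid-untagged : map proj₂ (verticals ++ horizontals) ≡ TnCEdges M (suc n′)
    grid-untagged = trans (map-++ proj₂ verticals horizontals)
      (cong₂ _++_ (sym (map-∘ (cartesianProduct (allFin M) (allFin (suc n′)))))
                  (sym (map-∘ (cartesianProduct (allFin M) (allFin n′)))))

  wrappedEdges-untagged :
    TnCEdges M (suc n′) ++ map (λ i → ((σ i , lastCol) , (i , zero))) (allFin M) ≡ map proj₂ (taggedEdges true)
  wrappedEdges-untagged = sym (trans (map-++ proj₂ (verticals ++ horizontals) (wrappings true))
    (cong₂ _++_ (trans (sym (++-identityʳ _))
                       (trans (sym (map-++ proj₂ (verticals ++ horizontals) [])) (sym TnCEdges-untagged)))
                (sym (map-∘ (allFin M)))))

module Graphs (k n′ p : ℕ) where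

  open CyclicRows k

  rowTG : Fin M → Fin M
  rowTG i = row M (toℕ i + 1 + p)

  rowKB : Fin M → Fin M
  rowKB i = row M (M + p + 1 ∸ (toℕ i + 1))

  module TnC = Grid k n′ (λ i → i) (λ i → i) (λ _ → refl) (λ _ → refl)
  module TG = Grid k n′ rowTG (prev^ p)
    (λ r → trans (row-TG p (prev^ p r)) (next^-prev^ p r))
    (λ i → trans (cong (prev^ p) (row-TG p i)) (prev^-next^ p i))
  module KB = Grid k n′ rowKB (λ r → opposite (prev^ p r))
    (λ r → trans (row-KB p (opposite (prev^ p r)))
                 (trans (cong (next^ p) (opposite-involutive (prev^ p r))) (next^-prev^ p r)))
    (λ i → trans (cong (λ r → opposite (prev^ p r)) (row-KB p i))
                 (trans (cong opposite (prev^-next^ p (opposite i))) (opposite-involutive i)))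

  fTnC≡T^n[0,0] : fTnC M (suc n′) ≡ (TStar M ^M suc n′) (zeroWord M) (zeroWord M)
  fTnC≡T^n[0,0] = trans (cong numTwoFactors TnC.TnCEdges-untagged) TnC.#twoFactors-open

  fTG≡twistedTrace : fTG M (suc n′) p ≡ twistedTrace (TStar M ^M suc n′) (ρ^ p)
  fTG≡twistedTrace = trans (cong numTwoFactors TG.wrappedEdges-untagged)
    (TG.#twoFactors-wrapped (ρ^ p) λ w r → trans (lookup-ρ^ p w r) (cong (lookup w) (sym (row-TG p r))))

  fKB≡twistedTrace : fKB M (suc n′) p ≡ twistedTrace (TStar M ^M suc n′) (λ u → bar (ρ^ p u))
  fKB≡twistedTrace = trans (cong numTwoFactors KB.wrappedEdges-untagged)
    (KB.#twoFactors-wrapped (λ u → bar (ρ^ p u)) λ w r →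
      trans (lookup-reverse (ρ^ p w) r) (trans (lookup-ρ^ p w (opposite r)) (cong (lookup w) (sym (row-KB p r)))))

theorem5 : (m n p : ℕ) .{{_ : NonZero m}} → 2 ≤ m → 1 ≤ n → p < m →
    (fTnC m n ≡ (TStar m ^M n) (zeroWord m) (zeroWord m))
    × (fTG m n p ≡ tr ((RStar m ^M p) ⊗ (TStar m ^M n)))
    × (fTG m n p ≡ tr ((TStar m ^M n) ⊗ (RStar m ^M p)))
    × (fTG m n p ≡ sum (map (λ vi → sum (map (λ vj → if ⌊ vi ≟W ρ^ p vj ⌋ then (TStar m ^M n) vi vj else 0) (VStar m))) (VStar m)))
    × (fKB m n p ≡ tr ((RStar m ^M p) ⊗ HStar m ⊗ (TStar m ^M n)))
    × (fKB m n p ≡ tr ((TStar m ^M n) ⊗ (RStar m ^M p) ⊗ HStar m))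
    × (fKB m n p ≡ sum (map (λ vi → sum (map (λ vj → if ⌊ bar vi ≟W ρ^ p vj ⌋ then (TStar m ^M n) vi vj else 0) (VStar m))) (VStar m)))
theorem5 (suc k) (suc n′) p _ _ _ =
  fTnC≡T^n[0,0] ,
  trans fTG≡twistedTrace (sym tr-R^p⊗M) ,
  trans fTG≡twistedTrace (sym tr-M⊗R^p) ,
  trans fTG≡twistedTrace (sym ∑-ρ^-pairs) ,
  trans fKB≡twistedTrace (sym tr-R^p⊗H⊗M) ,
  trans fKB≡twistedTrace (sym tr-M⊗R^p⊗H) ,
  trans fKB≡twistedTrace (sym ∑-barρ^-pairs)
  where
  open Graphs k n′ p
  open Traces (TStar (suc k) ^M suc n′) p
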